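{- Let $m$ be a positive integer and fix an $m$-weight file equivalence class of Ferrers boards, all fitting inside $\Delta_{N,m}$. Then the class contains a unique board $B_1$ and a unique board $B_2$ such that $\mathrm{dinv}_m B_1\le\mathrm{dinv}_m B\le\mathrm{dinv}_m B_2$ for all boards $B$ in the class (i.e. the minimum and the maximum of $\mathrm{dinv}_m$ on the class are each attained at exactly one board).
   Context: A Ferrers board is the set of cells given by weakly increasing nonnegative column heights (the $b_j$ lowest cells of column $j$ in the quadrant grid). $\Delta_{N,m}=(0,m,\dots,(N-1)m)$; a board fits in $\Delta_{N,m}$ if, padded on the left with zero columns to $N$ columns $(b_0,\dots,b_{N-1})$, $b_j\le jm$ for all $j$. For such a board written with these $N$ columns, $\omega_m(B)=(0-b_0,m-b_1,\dots,(N-1)m-b_{N-1})$. For a sequence $\pi=a_1\dots a_n$ of reals, $\mathrm{dinv}_m\pi=\sum_{k=0}^{m-1}|\{i<j:\ 0\le a_i-a_j+k\le m\}|$, and $\mathrm{dinv}_m B=\mathrm{dinv}_m(\omega_m(B))$. A file placement on $B$ is a set of cells (rooks) no two in the same column; with $y_i$ rooks in row $i$, $\mathrm{wt}_m F=\prod_i 1\downarrow_{y_i,m}$, where $x\downarrow_{y,m}=x(x-m)\cdots(x-(y-1)m)$, $x\downarrow_{0,m}=1$; $f_{k,m}(B)=\sum_F\mathrm{wt}_m F$ over file placements with $k$ rooks; $B,B'$ are $m$-weight file equivalent if $f_{k,m}(B)=f_{k,m}(B')$ for all $k$. -}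

module Defs where

open import Data.Nat as ℕ using (ℕ; zero; suc; _⊔_)
open import Data.Integer as ℤ using (ℤ; +_; _-_; _*_; _+_)
open import Data.Fin using (Fin; toℕ)
open import Data.Vec as Vec using (Vec; []; _∷_; lookup; toList)
open import Data.List as List using (List; []; _∷_; upTo; map; concatMap; filter; length)
open import Data.Maybe using (Maybe; just; nothing)
open import Data.Product using (_×_)
open import Relation.Nullary using (Dec; yes; no)
open import Relation.Nullary.Decidable using (⌊_⌋; _×-dec_)
open import Data.Bool using (Bool; T?)
open import Relation.Binary.PropositionalEquality using (_≡_)

-- Ferrers boards fitting in Δ_{N,m}, represented by their N column
-- heights (b_0,…,b_{N-1}) after padding on the left with zero columns.
-- Column j consists of the cells in rows 0,…,b_j - 1.

IsBoard : (N m : ℕ) → Vec ℕ N → Set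
IsBoard N m b =
  (∀ (i j : Fin N) → toℕ i ℕ.≤ toℕ j → lookup b i ℕ.≤ lookup b j)
  × (∀ (j : Fin N) → lookup b j ℕ.≤ toℕ j ℕ.* m)

ωm : ∀ {N} → ℕ → Vec ℕ N → Vec ℤ N
ωm {N} m b = Vec.tabulate (λ j → + (toℕ j ℕ.* m) - + lookup b j)

cond? : ℕ → ℕ → ℤ → ℤ → Bool
cond? m k ai aj = ⌊ (+ 0 ℤ.≤? ai - aj + + k) ×-dec (ai - aj + + k ℤ.≤? + m) ⌋

pairCount : ℕ → ℕ → List ℤ → ℕ
pairCount m k [] = 0
pairCount m k (a ∷ as) =
  length (filter (λ b → T? (cond? m k a b)) as) ℕ.+ pairCount m k as

dinvSeq : ℕ → List ℤ → ℕ
dinvSeq m π = List.foldr ℕ._+_ 0 (map (λ k → pairCount m k π) (upTo m))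

dinv : ∀ {N} → ℕ → Vec ℕ N → ℕ
dinv m b = dinvSeq m (toList (ωm m b))

-- File placements: for each column, either no rook or a rook in one of
-- its rows 0,…,b_j - 1.

placements : List ℕ → List (List (Maybe ℕ))
placements [] = [] ∷ []
placements (h ∷ hs) =
  concatMap (λ p → (nothing ∷ p) ∷ map (λ r → just r ∷ p) (upTo h)) (placements hs)

rooks : List (Maybe ℕ) → ℕ
rooks [] = 0
rooks (nothing ∷ p) = rooks p
rooks (just _ ∷ p) = suc (rooks p)

rowCount : ℕ → List (Maybe ℕ) → ℕ
rowCount i [] = 0
rowCount i (nothing ∷ p) = rowCount i p
rowCount i (just r ∷ p) with r ℕ.≟ i
... | yes _ = suc (rowCount i p)
... | no _ = rowCount i p

fall : ℤ → ℕ → ℕ → ℤ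
fall x zero m = + 1
fall x (suc y) m = fall x y m * (x - + (y ℕ.* m))

-- wt_m F = ∏_i 1 ↓_{y_i,m}  (rows ≥ max height hold no rooks, factor 1)
wt : ℕ → List ℕ → List (Maybe ℕ) → ℤ
wt m hs p = List.foldr _*_ (+ 1)
  (map (λ i → fall (+ 1) (rowCount i p) m) (upTo (List.foldr _⊔_ 0 hs)))

fileNum : ℕ → ℕ → ∀ {N} → Vec ℕ N → ℤ
fileNum k m b = List.foldr _+_ (+ 0)
  (map (wt m (toList b)) (filter (λ p → rooks p ℕ.≟ k) (placements (toList b))))

FileEquiv : ℕ → ∀ {N} → Vec ℕ N → Vec ℕ N → Set
FileEquiv m b b' = ∀ (k : ℕ) → fileNum k m b ≡ fileNum k m b'

InClass : (N m : ℕ) → Vec ℕ N → Vec ℕ N → Set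
InClass N m b₀ b = IsBoard N m b × FileEquiv m b b₀

module Submission where

-- A board B is recorded through ω = ω_m(B).  The boards fitting in Δ_{N,m}
-- correspond bijectively to the admissible sequences ω of length N
-- (ω₀ = 0, all ω_j ≥ 0, ω_{j+1} ≤ ω_j + m).  The proof combines:
--  (1) Factorization.  Reading the columns from the tallest one, the file
--      numbers obey a recurrence in the entries of ω, and
--      Σ_k f_{k,m}(B) · z↓_{N-k,m} = ∏_j (z - ω_j).  Hence two boards are
--      m-weight file equivalent iff their ω-sequences are permutations of
--      each other.
--  (2) Exchange.  Write asc ω (desc ω) for the number of pairs i < j with
--      1 ≤ ω_j - ω_i ≤ m (1 ≤ ω_i - ω_j ≤ m).  Both dinv_m ω + asc ω and
--      asc ω + desc ω are invariant under permutations of ω.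
--  (3) Extremal arrangements of an admissible multiset: the arrangements
--      with desc = 0 are exactly the weakly increasing ones (so there is
--      one); every admissible arrangement has asc ≥ #(positive entries), and
--      exactly one admissible arrangement attains this bound.
-- So dinv_m is minimal exactly when desc vanishes and maximal exactly when
-- asc is minimal, and the theorem follows from (1)-(3) by transport along ω.

open import Defs
open import Algebra.Bundles using (AbelianGroup)
open import Data.Nat as ℕ using (ℕ; zero; suc; _⊔_; _∸_; _≤_; _<_; z≤n; s≤s)
import Data.Nat.Properties as ℕP
open import Data.Nat.ListAction using (sum)
open import Data.Nat.ListAction.Properties using (sum-++; sum-↭)
open import Data.Nat.Tactic.RingSolver using () renaming (solve-∀ to solveℕ)
open import Data.Integer as ℤ using (ℤ; +_; -_; _-_; _+_; _*_; ∣_∣)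
import Data.Integer.Properties as ℤP
open import Data.Integer.Tactic.RingSolver using (solve-∀)
open import Data.List as List using (List; []; _∷_; _++_; _∷ʳ_; map; upTo; applyUpTo; length; filter; reverse; initLast; _∷ʳ′_)
import Data.List.Properties as LP
open import Data.List.Relation.Unary.All as All using (All; []; _∷_)
import Data.List.Relation.Unary.All.Properties as AllP
open import Data.List.Relation.Unary.AllPairs using (AllPairs; []; _∷_)
import Data.List.Relation.Unary.AllPairs.Properties as AllPairsP
open import Data.List.Relation.Unary.Any as Any using (Any; here; there)
open import Data.List.Relation.Unary.Linked using (Linked; []; [-]; _∷_)
open import Data.List.Relation.Unary.Linked.Properties using (AllPairs⇒Linked; Linked⇒All; Linked⇒AllPairs)
import Data.List.Relation.Binary.Permutation.Propositional as Perm
open Perm using (_↭_; ↭-sym; ↭-trans)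
import Data.List.Relation.Binary.Permutation.Propositional.Properties as PermP
open import Data.List.Membership.Propositional using (_∈_)
open import Data.List.Membership.Propositional.Properties using (∈-∃++)
open import Data.Vec as Vec using (Vec; toList; lookup)
import Data.Vec.Properties as VecP
import Data.Vec.Relation.Unary.All.Properties as VecAllP
open import Data.Fin as Fin using (Fin; toℕ)
open import Data.Maybe using (Maybe; just; nothing)
open import Data.Bool using (Bool; true; false; T?)
open import Data.Product using (Σ; _×_; _,_; proj₁; proj₂)
open import Data.Sum using (_⊎_; inj₁; inj₂)
open import Data.Unit using (⊤; tt)
open import Data.Empty using (⊥; ⊥-elim)
open import Function using (_∘_)
open import Relation.Nullary using (Dec; yes; no; ¬_)
open import Relation.Nullary.Decidable using (⌊_⌋; _×-dec_)
open import Relation.Binary.Definitions using (tri<; tri≈; tri>)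
open import Relation.Binary.PropositionalEquality
open import Algebra.Properties.CommutativeSemigroup ℕP.+-commutativeSemigroup
  using () renaming (interchange to +-interchangeℕ)
open import Algebra.Properties.CommutativeSemigroup ℤP.+-commutativeSemigroup
  using () renaming (interchange to +-interchangeℤ)
open import Algebra.Properties.Group (AbelianGroup.group ℤP.+-0-abelianGroup)
  using () renaming (∙-cancelʳ to +-cancelʳℤ)

Σℤ : ℕ → (ℕ → ℤ) → ℤ
Σℤ zero    f = + 0
Σℤ (suc n) f = f 0 + Σℤ n (f ∘ suc)

Σℕ : ℕ → (ℕ → ℕ) → ℕ
Σℕ zero    f = 0
Σℕ (suc n) f = f 0 ℕ.+ Σℕ n (f ∘ suc)

Πℤ : ℕ → (ℕ → ℤ) → ℤ
Πℤ zero    f = + 1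
Πℤ (suc n) f = f 0 * Πℤ n (f ∘ suc)

sumℤ : List ℤ → ℤ
sumℤ = List.foldr _+_ (+ 0)

Σℤ-cong : ∀ n {f g : ℕ → ℤ} → (∀ i → i < n → f i ≡ g i) → Σℤ n f ≡ Σℤ n g
Σℤ-cong zero    eq = refl
Σℤ-cong (suc n) eq = cong₂ _+_ (eq 0 (s≤s z≤n)) (Σℤ-cong n (λ i i<n → eq (suc i) (s≤s i<n)))

Σℤ-+ : ∀ n (f g : ℕ → ℤ) → Σℤ n (λ i → f i + g i) ≡ Σℤ n f + Σℤ n g
Σℤ-+ zero    f g = refl
Σℤ-+ (suc n) f g = trans (cong (_+_ (f 0 + g 0)) (Σℤ-+ n (f ∘ suc) (g ∘ suc)))
                         (+-interchangeℤ (f 0) (g 0) (Σℤ n (f ∘ suc)) (Σℤ n (g ∘ suc)))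

Σℤ-* : ∀ n c (f : ℕ → ℤ) → Σℤ n (λ i → c * f i) ≡ c * Σℤ n f
Σℤ-* zero    c f = sym (ℤP.*-zeroʳ c)
Σℤ-* (suc n) c f = trans (cong (_+_ (c * f 0)) (Σℤ-* n c (f ∘ suc)))
                         (sym (ℤP.*-distribˡ-+ c (f 0) (Σℤ n (f ∘ suc))))

Σℤ-zero : ∀ n → Σℤ n (λ _ → + 0) ≡ + 0
Σℤ-zero zero    = refl
Σℤ-zero (suc n) = trans (ℤP.+-identityˡ _) (Σℤ-zero n)

Σℤ-swap : ∀ a b (f : ℕ → ℕ → ℤ) → Σℤ a (λ i → Σℤ b (f i)) ≡ Σℤ b (λ j → Σℤ a (λ i → f i j))
Σℤ-swap zero    b f = sym (Σℤ-zero b)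
Σℤ-swap (suc a) b f =
  trans (cong (_+_ (Σℤ b (f 0))) (Σℤ-swap a b (f ∘ suc)))
        (sym (Σℤ-+ b (f 0) (λ j → Σℤ a (λ i → f (suc i) j))))

Σℕ-cong : ∀ n {f g : ℕ → ℕ} → (∀ i → i < n → f i ≡ g i) → Σℕ n f ≡ Σℕ n g
Σℕ-cong zero    eq = refl
Σℕ-cong (suc n) eq = cong₂ ℕ._+_ (eq 0 (s≤s z≤n)) (Σℕ-cong n (λ i i<n → eq (suc i) (s≤s i<n)))

Σℕ-+ : ∀ n (f g : ℕ → ℕ) → Σℕ n (λ i → f i ℕ.+ g i) ≡ Σℕ n f ℕ.+ Σℕ n g
Σℕ-+ zero    f g = refl
Σℕ-+ (suc n) f g = trans (cong ((f 0 ℕ.+ g 0) ℕ.+_) (Σℕ-+ n (f ∘ suc) (g ∘ suc)))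
                         (+-interchangeℕ (f 0) (g 0) (Σℕ n (f ∘ suc)) (Σℕ n (g ∘ suc)))

Σℕ-zero : ∀ n → Σℕ n (λ _ → 0) ≡ 0
Σℕ-zero zero    = refl
Σℕ-zero (suc n) = Σℕ-zero n

Σℕ-snoc : ∀ n f → Σℕ (suc n) f ≡ Σℕ n f ℕ.+ f n
Σℕ-snoc zero    f = ℕP.+-comm (f 0) 0
Σℕ-snoc (suc n) f = trans (cong (f 0 ℕ.+_) (Σℕ-snoc n (f ∘ suc))) (sym (ℕP.+-assoc (f 0) _ _))

Σℕ-reverse : ∀ n g → Σℕ n g ≡ Σℕ n (λ j → g (n ∸ suc j))
Σℕ-reverse zero    g = refl
Σℕ-reverse (suc n) g = begin
  Σℕ (suc n) g                              ≡⟨ Σℕ-snoc n g ⟩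
  Σℕ n g ℕ.+ g n                            ≡⟨ cong (ℕ._+ g n) (Σℕ-reverse n g) ⟩
  Σℕ n (λ j → g (n ∸ suc j)) ℕ.+ g n        ≡⟨ ℕP.+-comm _ (g n) ⟩
  Σℕ (suc n) (λ j → g (suc n ∸ suc j))      ∎
  where open ≡-Reasoning

Σℕ-shift : ∀ n (h : ℕ → ℕ) → Σℕ n (h ∘ suc) ℕ.+ h 0 ≡ Σℕ n h ℕ.+ h n
Σℕ-shift zero    h = refl
Σℕ-shift (suc n) h = begin
  h 1 ℕ.+ Σℕ n (h ∘ suc ∘ suc) ℕ.+ h 0     ≡⟨ ℕP.+-comm (h 1 ℕ.+ _) (h 0) ⟩
  h 0 ℕ.+ (h 1 ℕ.+ Σℕ n (h ∘ suc ∘ suc))   ≡⟨ cong (h 0 ℕ.+_) (trans (ℕP.+-comm (h 1) _) (Σℕ-shift n (h ∘ suc))) ⟩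
  h 0 ℕ.+ (Σℕ n (h ∘ suc) ℕ.+ h (suc n))   ≡⟨ ℕP.+-assoc (h 0) _ _ ⟨
  Σℕ (suc n) h ℕ.+ h (suc n)               ∎
  where open ≡-Reasoning

Πℤ-cong : ∀ n {u v : ℕ → ℤ} → (∀ i → u i ≡ v i) → Πℤ n u ≡ Πℤ n v
Πℤ-cong zero    eq = refl
Πℤ-cong (suc n) eq = cong₂ _*_ (eq 0) (Πℤ-cong n (λ i → eq (suc i)))

Πℤ-one : ∀ n → Πℤ n (λ _ → + 1) ≡ + 1
Πℤ-one zero    = refl
Πℤ-one (suc n) = trans (ℤP.*-identityˡ _) (Πℤ-one n)

Πℤ-point : ∀ n r (u v : ℕ → ℤ) c → r < n → (∀ i → i ≢ r → u i ≡ v i) → u r ≡ v r * c →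
           Πℤ n u ≡ Πℤ n v * c
Πℤ-point (suc n) zero u v c _ same eq =
  trans (cong₂ _*_ eq (Πℤ-cong n (λ i → same (suc i) (λ ())))) (swap (v 0) c (Πℤ n (v ∘ suc)))
  where
  swap : ∀ a b d → a * b * d ≡ a * d * b
  swap = solve-∀
Πℤ-point (suc n) (suc r) u v c (s≤s r<n) same eq =
  trans (cong₂ _*_ (same 0 (λ ()))
          (Πℤ-point n r (u ∘ suc) (v ∘ suc) c r<n (λ i i≢r → same (suc i) (i≢r ∘ ℕP.suc-injective)) eq))
        (sym (ℤP.*-assoc (v 0) (Πℤ n (v ∘ suc)) c))

sumℤ-applyUpTo : ∀ n (f : ℕ → ℤ) (g : ℕ → ℕ) → sumℤ (map f (applyUpTo g n)) ≡ Σℤ n (f ∘ g)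
sumℤ-applyUpTo zero    f g = refl
sumℤ-applyUpTo (suc n) f g = cong (_+_ (f (g 0))) (sumℤ-applyUpTo n f (g ∘ suc))

prodℤ-applyUpTo : ∀ n (f : ℕ → ℤ) (g : ℕ → ℕ) →
                  List.foldr _*_ (+ 1) (map f (applyUpTo g n)) ≡ Πℤ n (f ∘ g)
prodℤ-applyUpTo zero    f g = refl
prodℤ-applyUpTo (suc n) f g = cong (f (g 0) *_) (prodℤ-applyUpTo n f (g ∘ suc))

sum-applyUpTo : ∀ n (f : ℕ → ℕ) (g : ℕ → ℕ) → sum (map f (applyUpTo g n)) ≡ Σℕ n (f ∘ g)
sum-applyUpTo zero    f g = refl
sum-applyUpTo (suc n) f g = cong (f (g 0) ℕ.+_) (sum-applyUpTo n f (g ∘ suc))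

sumℤ-++ : ∀ xs ys → sumℤ (xs ++ ys) ≡ sumℤ xs + sumℤ ys
sumℤ-++ []       ys = sym (ℤP.+-identityˡ _)
sumℤ-++ (x ∷ xs) ys = trans (cong (_+_ x) (sumℤ-++ xs ys)) (sym (ℤP.+-assoc x (sumℤ xs) (sumℤ ys)))

sumℤ-map-+ : ∀ {A : Set} (f g : A → ℤ) (L : List A) →
             sumℤ (map (λ p → f p + g p) L) ≡ sumℤ (map f L) + sumℤ (map g L)
sumℤ-map-+ f g []      = refl
sumℤ-map-+ f g (x ∷ L) = trans (cong (_+_ (f x + g x)) (sumℤ-map-+ f g L))
                               (+-interchangeℤ (f x) (g x) (sumℤ (map f L)) (sumℤ (map g L)))

sumℤ-map-* : ∀ {A : Set} c (f : A → ℤ) (L : List A) → sumℤ (map (λ p → c * f p) L) ≡ c * sumℤ (map f L)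
sumℤ-map-* c f []      = sym (ℤP.*-zeroʳ c)
sumℤ-map-* c f (x ∷ L) = trans (cong (_+_ (c * f x)) (sumℤ-map-* c f L))
                               (sym (ℤP.*-distribˡ-+ c (f x) (sumℤ (map f L))))

sumℤ-map-cong : ∀ {A : Set} {f g : A → ℤ} (L : List A) → (∀ p → f p ≡ g p) → sumℤ (map f L) ≡ sumℤ (map g L)
sumℤ-map-cong L eq = cong sumℤ (LP.map-cong eq L)

sumℤ-concatMap : ∀ {A : Set} (f : A → ℤ) (g : A → List A) (L : List A) →
                 sumℤ (map f (List.concatMap g L)) ≡ sumℤ (map (λ p → sumℤ (map f (g p))) L)
sumℤ-concatMap f g []      = refl
sumℤ-concatMap f g (x ∷ L) = begin
  sumℤ (map f (g x ++ List.concatMap g L))                   ≡⟨ cong sumℤ (LP.map-++ f (g x) _) ⟩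
  sumℤ (map f (g x) ++ map f (List.concatMap g L))           ≡⟨ sumℤ-++ (map f (g x)) _ ⟩
  sumℤ (map f (g x)) + sumℤ (map f (List.concatMap g L))     ≡⟨ cong (_+_ (sumℤ (map f (g x)))) (sumℤ-concatMap f g L) ⟩
  sumℤ (map (λ p → sumℤ (map f (g p))) (x ∷ L))             ∎
  where open ≡-Reasoning

sum-map-+ : ∀ {A : Set} (f g : A → ℕ) (L : List A) → sum (map (λ p → f p ℕ.+ g p) L) ≡ sum (map f L) ℕ.+ sum (map g L)
sum-map-+ f g []      = refl
sum-map-+ f g (x ∷ L) = trans (cong ((f x ℕ.+ g x) ℕ.+_) (sum-map-+ f g L))
                              (+-interchangeℕ (f x) (g x) (sum (map f L)) (sum (map g L)))

sum-map-zero : ∀ {A : Set} (f : A → ℕ) xs → All (λ a → f a ≡ 0) xs → sum (map f xs) ≡ 0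
sum-map-zero f []       []       = refl
sum-map-zero f (x ∷ xs) (e ∷ es) = trans (cong (ℕ._+ sum (map f xs)) e) (sum-map-zero f xs es)

sum-map-zero⁻ : ∀ {A : Set} (f : A → ℕ) xs → sum (map f xs) ≡ 0 → All (λ a → f a ≡ 0) xs
sum-map-zero⁻ f []       _ = []
sum-map-zero⁻ f (x ∷ xs) e = ℕP.m+n≡0⇒m≡0 (f x) e ∷ sum-map-zero⁻ f xs (ℕP.m+n≡0⇒n≡0 (f x) e)

Placement : Set
Placement = List (Maybe ℕ)

ΣPl : List ℕ → (Placement → ℤ) → ℤ
ΣPl hs f = sumℤ (map f (placements hs))

ΣPl-cong : ∀ hs {f g : Placement → ℤ} → (∀ p → f p ≡ g p) → ΣPl hs f ≡ ΣPl hs g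
ΣPl-cong hs = sumℤ-map-cong (placements hs)

addColumn : ℕ → (Placement → ℤ) → Placement → ℤ
addColumn h f p = f (nothing ∷ p) + Σℤ h (λ r → f (just r ∷ p))

ΣPl-cons : ∀ h hs f → ΣPl (h ∷ hs) f ≡ ΣPl hs (addColumn h f)
ΣPl-cons h hs f =
  trans (sumℤ-concatMap f _ (placements hs))
        (ΣPl-cong hs λ p → cong (_+_ (f (nothing ∷ p)))
          (trans (cong sumℤ (sym (LP.map-∘ (upTo h)))) (sumℤ-applyUpTo h (λ r → f (just r ∷ p)) (λ r → r))))

-- f does not see the order of its columns (it suffices to swap neighbours).
SwapInvariant : (Placement → ℤ) → Set
SwapInvariant f = ∀ q o o′ p → f (q ++ o ∷ o′ ∷ p) ≡ f (q ++ o′ ∷ o ∷ p)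

addColumn-swapInvariant : ∀ h f → SwapInvariant f → SwapInvariant (addColumn h f)
addColumn-swapInvariant h f inv q o o′ p =
  cong₂ _+_ (inv (nothing ∷ q) o o′ p) (Σℤ-cong h (λ r _ → inv (just r ∷ q) o o′ p))

addColumn-comm : ∀ x y f → SwapInvariant f → ∀ p → addColumn y (addColumn x f) p ≡ addColumn x (addColumn y f) p
addColumn-comm x y f inv p = begin
    (A + B) + Σℤ y (λ r′ → f (nothing ∷ just r′ ∷ p) + Σℤ x (λ r → f (just r ∷ just r′ ∷ p)))
  ≡⟨ cong (_+_ (A + B)) (Σℤ-+ y _ _) ⟩
    (A + B) + (C + D)
  ≡⟨ +-interchangeℤ A B C D ⟩
    (A + C) + (B + D)
  ≡⟨ cong₂ (λ u v → (A + u) + v) C≡C′ (cong₂ _+_ B≡B′ D≡D′) ⟩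
    (A + C′) + (B′ + D′)
  ≡⟨ cong (_+_ (A + C′)) (Σℤ-+ x _ _) ⟨
    (A + C′) + Σℤ x (λ r → f (nothing ∷ just r ∷ p) + Σℤ y (λ r′ → f (just r′ ∷ just r ∷ p)))
  ∎
  where
  open ≡-Reasoning
  A B C D B′ C′ D′ : ℤ
  A = f (nothing ∷ nothing ∷ p)
  B = Σℤ x (λ r → f (just r ∷ nothing ∷ p))
  C = Σℤ y (λ r′ → f (nothing ∷ just r′ ∷ p))
  D = Σℤ y (λ r′ → Σℤ x (λ r → f (just r ∷ just r′ ∷ p)))
  C′ = Σℤ y (λ r′ → f (just r′ ∷ nothing ∷ p))
  B′ = Σℤ x (λ r → f (nothing ∷ just r ∷ p))
  D′ = Σℤ x (λ r → Σℤ y (λ r′ → f (just r′ ∷ just r ∷ p)))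
  C≡C′ : C ≡ C′
  C≡C′ = Σℤ-cong y (λ r′ _ → inv [] nothing (just r′) p)
  B≡B′ : B ≡ B′
  B≡B′ = Σℤ-cong x (λ r _ → inv [] (just r) nothing p)
  D≡D′ : D ≡ D′
  D≡D′ = trans (Σℤ-cong y (λ r′ _ → Σℤ-cong x (λ r _ → inv [] (just r) (just r′) p)))
               (Σℤ-swap y x (λ r′ r → f (just r′ ∷ just r ∷ p)))

ΣPl-↭ : ∀ {hs hs′} → hs ↭ hs′ → ∀ f → SwapInvariant f → ΣPl hs f ≡ ΣPl hs′ f
ΣPl-↭ Perm.refl f inv = refl
ΣPl-↭ {h ∷ xs} {h ∷ ys} (Perm.prep h σ) f inv =
  trans (ΣPl-cons h xs f) (trans (ΣPl-↭ σ (addColumn h f) (addColumn-swapInvariant h f inv)) (sym (ΣPl-cons h ys f)))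
ΣPl-↭ {x ∷ y ∷ xs} {y ∷ x ∷ ys} (Perm.swap x y σ) f inv = begin
  ΣPl (x ∷ y ∷ xs) f                        ≡⟨ trans (ΣPl-cons x (y ∷ xs) f) (ΣPl-cons y xs (addColumn x f)) ⟩
  ΣPl xs (addColumn y (addColumn x f))      ≡⟨ ΣPl-↭ σ _ (addColumn-swapInvariant y (addColumn x f) (addColumn-swapInvariant x f inv)) ⟩
  ΣPl ys (addColumn y (addColumn x f))      ≡⟨ ΣPl-cong ys (addColumn-comm x y f inv) ⟩
  ΣPl ys (addColumn x (addColumn y f))      ≡⟨ trans (ΣPl-cons y (x ∷ ys) f) (ΣPl-cons x ys (addColumn y f)) ⟨
  ΣPl (y ∷ x ∷ ys) f                        ∎
  where open ≡-Reasoning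
ΣPl-↭ (Perm.trans σ τ) f inv = trans (ΣPl-↭ σ f inv) (ΣPl-↭ τ f inv)

bit : Bool → ℕ
bit true  = 1
bit false = 0

bit-⇔ : ∀ {P Q : Set} → (P → Q) → (Q → P) → (p : Dec P) (q : Dec Q) → bit ⌊ p ⌋ ≡ bit ⌊ q ⌋
bit-⇔ f g (yes _) (yes _) = refl
bit-⇔ f g (no _)  (no _)  = refl
bit-⇔ f g (yes p) (no ¬q) = ⊥-elim (¬q (f p))
bit-⇔ f g (no ¬p) (yes q) = ⊥-elim (¬p (g q))

bit-no : ∀ {P : Set} → ¬ P → (p : Dec P) → bit ⌊ p ⌋ ≡ 0
bit-no ¬p (yes p) = ⊥-elim (¬p p)
bit-no ¬p (no _)  = refl

bit-yes : ∀ {P : Set} → P → (p : Dec P) → bit ⌊ p ⌋ ≡ 1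
bit-yes p (yes _) = refl
bit-yes p (no ¬p) = ⊥-elim (¬p p)

δ : ℕ → ℕ → ℕ
δ r i = bit ⌊ r ℕ.≟ i ⌋

δ-refl : ∀ r → δ r r ≡ 1
δ-refl r = bit-yes refl (r ℕ.≟ r)

δ-≢ : ∀ {r i} → r ≢ i → δ r i ≡ 0
δ-≢ {r} {i} r≢i = bit-no r≢i (r ℕ.≟ i)

δ-suc : ∀ r i → δ (suc r) (suc i) ≡ δ r i
δ-suc r i = bit-⇔ ℕP.suc-injective (cong suc) (suc r ℕ.≟ suc i) (r ℕ.≟ i)

rowHit : ℕ → Maybe ℕ → ℕ
rowHit i nothing  = 0
rowHit i (just r) = δ r i

rookAt : Maybe ℕ → ℕ
rookAt nothing  = 0
rookAt (just _) = 1

rowCount-just : ∀ r i p → rowCount i (just r ∷ p) ≡ δ r i ℕ.+ rowCount i p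
rowCount-just r i p with r ℕ.≟ i
... | yes _ = refl
... | no _  = refl

rowCount-sum : ∀ i p → rowCount i p ≡ sum (map (rowHit i) p)
rowCount-sum i []             = refl
rowCount-sum i (nothing ∷ p)  = rowCount-sum i p
rowCount-sum i (just r ∷ p)   = trans (rowCount-just r i p) (cong (δ r i ℕ.+_) (rowCount-sum i p))

rooks-sum : ∀ p → rooks p ≡ sum (map rookAt p)
rooks-sum []            = refl
rooks-sum (nothing ∷ p) = rooks-sum p
rooks-sum (just _ ∷ p)  = cong suc (rooks-sum p)

swap↭ : ∀ {A : Set} (q : List A) o o′ p → q ++ o ∷ o′ ∷ p ↭ q ++ o′ ∷ o ∷ p
swap↭ q o o′ p = PermP.++⁺ˡ q (Perm.swap o o′ Perm.refl)

rowCount-swap : ∀ i q o o′ p → rowCount i (q ++ o ∷ o′ ∷ p) ≡ rowCount i (q ++ o′ ∷ o ∷ p)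
rowCount-swap i q o o′ p =
  trans (rowCount-sum i (q ++ o ∷ o′ ∷ p))
        (trans (sum-↭ (PermP.map⁺ (rowHit i) (swap↭ q o o′ p))) (sym (rowCount-sum i (q ++ o′ ∷ o ∷ p))))

rooks-swap : ∀ q o o′ p → rooks (q ++ o ∷ o′ ∷ p) ≡ rooks (q ++ o′ ∷ o ∷ p)
rooks-swap q o o′ p =
  trans (rooks-sum (q ++ o ∷ o′ ∷ p))
        (trans (sum-↭ (PermP.map⁺ rookAt (swap↭ q o o′ p))) (sym (rooks-sum (q ++ o′ ∷ o ∷ p))))

wt-cong : ∀ m hs p p′ → (∀ i → rowCount i p ≡ rowCount i p′) → wt m hs p ≡ wt m hs p′
wt-cong m hs p p′ eq =
  cong (List.foldr _*_ (+ 1)) (LP.map-cong (λ i → cong (λ y → fall (+ 1) y m) (eq i)) (upTo (List.foldr _⊔_ 0 hs)))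

keepIf : ∀ {A : Set} → Dec A → ℤ → ℤ
keepIf (yes _) x = x
keepIf (no _)  x = + 0

wtWithRooks : ℕ → List ℕ → ℕ → Placement → ℤ
wtWithRooks m hs k p = keepIf (rooks p ℕ.≟ k) (wt m hs p)

wtWithRooks-swapInvariant : ∀ m hs k → SwapInvariant (wtWithRooks m hs k)
wtWithRooks-swapInvariant m hs k q o o′ p =
  respect {q ++ o ∷ o′ ∷ p} {q ++ o′ ∷ o ∷ p} (rooks-swap q o o′ p) (wt-cong m hs (q ++ o ∷ o′ ∷ p) (q ++ o′ ∷ o ∷ p) (λ i → rowCount-swap i q o o′ p))
  where
  respect : ∀ {p p′} → rooks p ≡ rooks p′ → wt m hs p ≡ wt m hs p′ → wtWithRooks m hs k p ≡ wtWithRooks m hs k p′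
  respect {p} {p′} e₁ e₂ with rooks p ℕ.≟ k | rooks p′ ℕ.≟ k
  ... | yes _ | yes _ = e₂
  ... | no _  | no _  = refl
  ... | yes a | no b  = ⊥-elim (b (trans (sym e₁) a))
  ... | no a  | yes b = ⊥-elim (a (trans e₁ b))

sumℤ-filter : ∀ m hs k (L : List Placement) →
              sumℤ (map (wt m hs) (filter (λ p → rooks p ℕ.≟ k) L)) ≡ sumℤ (map (wtWithRooks m hs k) L)
sumℤ-filter m hs k [] = refl
sumℤ-filter m hs k (p ∷ L) with rooks p ℕ.≟ k
... | yes has-k = trans (cong (sumℤ ∘ map (wt m hs)) (LP.filter-accept (λ q → rooks q ℕ.≟ k) {p} {L} has-k))
                        (cong (_+_ (wt m hs p)) (sumℤ-filter m hs k L))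
... | no ¬has-k = trans (cong (sumℤ ∘ map (wt m hs)) (LP.filter-reject (λ q → rooks q ℕ.≟ k) {p} {L} ¬has-k))
                        (trans (sumℤ-filter m hs k L) (sym (ℤP.+-identityˡ _)))

fileNum-ΣPl : ∀ k m {N} (b : Vec ℕ N) → fileNum k m b ≡ ΣPl (toList b) (wtWithRooks m (toList b) k)
fileNum-ΣPl k m b = sumℤ-filter m (toList b) k (placements (toList b))

maxHeight : List ℕ → ℕ
maxHeight = List.foldr _⊔_ 0

wt-Πℤ : ∀ m hs p → wt m hs p ≡ Πℤ (maxHeight hs) (λ i → fall (+ 1) (rowCount i p) m)
wt-Πℤ m hs p = prodℤ-applyUpTo (maxHeight hs) (λ i → fall (+ 1) (rowCount i p) m) (λ i → i)

wt-empty : ∀ m hs → wt m hs [] ≡ + 1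
wt-empty m hs = trans (wt-Πℤ m hs []) (Πℤ-one (maxHeight hs))

wt-addRook : ∀ m hs r p → r < maxHeight hs → wt m hs (just r ∷ p) ≡ wt m hs p * (+ 1 - + (rowCount r p ℕ.* m))
wt-addRook m hs r p r<max = begin
  wt m hs (just r ∷ p)                                       ≡⟨ wt-Πℤ m hs (just r ∷ p) ⟩
  Πℤ (maxHeight hs) (λ i → fall (+ 1) (rowCount i (just r ∷ p)) m)
    ≡⟨ Πℤ-point (maxHeight hs) r _ _ _ r<max otherRows rowR ⟩
  Πℤ (maxHeight hs) (λ i → fall (+ 1) (rowCount i p) m) * (+ 1 - + (rowCount r p ℕ.* m))
    ≡⟨ cong (_* (+ 1 - + (rowCount r p ℕ.* m))) (wt-Πℤ m hs p) ⟨
  wt m hs p * (+ 1 - + (rowCount r p ℕ.* m))                 ∎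
  where
  open ≡-Reasoning
  otherRows : ∀ i → i ≢ r → fall (+ 1) (rowCount i (just r ∷ p)) m ≡ fall (+ 1) (rowCount i p) m
  otherRows i i≢r = cong (λ y → fall (+ 1) y m)
    (trans (rowCount-just r i p) (cong (ℕ._+ rowCount i p) (δ-≢ (i≢r ∘ sym))))
  rowR : fall (+ 1) (rowCount r (just r ∷ p)) m ≡ fall (+ 1) (rowCount r p) m * (+ 1 - + (rowCount r p ℕ.* m))
  rowR = cong (λ y → fall (+ 1) y m) (trans (rowCount-just r r p) (cong (ℕ._+ rowCount r p) (δ-refl r)))

RowsBelow : ℕ → Placement → Set
RowsBelow H []             = ⊤
RowsBelow H (nothing ∷ p)  = RowsBelow H p
RowsBelow H (just r ∷ p)   = r < H × RowsBelow H p

Σℕ-δ : ∀ h s → s < h → Σℕ h (δ s) ≡ 1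
Σℕ-δ (suc h) zero    _ =
  cong₂ ℕ._+_ (δ-refl 0) (trans (Σℕ-cong h (λ i _ → δ-≢ {0} {suc i} (λ ()))) (Σℕ-zero h))
Σℕ-δ (suc h) (suc s) (s≤s s<h) =
  cong₂ ℕ._+_ (δ-≢ {suc s} {0} (λ ())) (trans (Σℕ-cong h (λ i _ → δ-suc s i)) (Σℕ-δ h s s<h))

Σℕ-rowCount : ∀ h p → RowsBelow h p → Σℕ h (λ r → rowCount r p) ≡ rooks p
Σℕ-rowCount h []            _ = Σℕ-zero h
Σℕ-rowCount h (nothing ∷ p) below = Σℕ-rowCount h p below
Σℕ-rowCount h (just s ∷ p) (s<h , below) =
  trans (Σℕ-cong h (λ r _ → rowCount-just s r p))
        (trans (Σℕ-+ h (δ s) (λ r → rowCount r p)) (cong₂ ℕ._+_ (Σℕ-δ h s s<h) (Σℕ-rowCount h p below)))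

Σℤ-oneMinus : ∀ m h (c : ℕ → ℕ) → Σℤ h (λ r → + 1 - + (c r ℕ.* m)) ≡ + h - + (Σℕ h c ℕ.* m)
Σℤ-oneMinus m zero    c = refl
Σℤ-oneMinus m (suc h) c = begin
  + 1 - + (c 0 ℕ.* m) + Σℤ h (λ r → + 1 - + (c (suc r) ℕ.* m))
    ≡⟨ cong (_+_ (+ 1 - + (c 0 ℕ.* m))) (Σℤ-oneMinus m h (c ∘ suc)) ⟩
  + 1 - + (c 0 ℕ.* m) + (+ h - + (Σℕ h (c ∘ suc) ℕ.* m))
    ≡⟨ regroup (+ h) (+ (c 0 ℕ.* m)) (+ (Σℕ h (c ∘ suc) ℕ.* m)) ⟩
  (+ 1 + + h) - (+ (c 0 ℕ.* m) + + (Σℕ h (c ∘ suc) ℕ.* m))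
    ≡⟨ cong₂ _-_ (sym (ℤP.pos-+ 1 h))
         (trans (sym (ℤP.pos-+ (c 0 ℕ.* m) _)) (cong +_ (sym (ℕP.*-distribʳ-+ m (c 0) (Σℕ h (c ∘ suc)))))) ⟩
  + suc h - + (Σℕ (suc h) c ℕ.* m)                           ∎
  where
  open ≡-Reasoning
  regroup : ∀ a b d → + 1 - b + (a - d) ≡ + 1 + a - (b + d)
  regroup = solve-∀

Σℤ-wt-addRook : ∀ m hs h p → h ≤ maxHeight hs → RowsBelow h p →
                Σℤ h (λ r → wt m hs (just r ∷ p)) ≡ wt m hs p * (+ h - + (rooks p ℕ.* m))
Σℤ-wt-addRook m hs h p h≤max below = begin
  Σℤ h (λ r → wt m hs (just r ∷ p))                           ≡⟨ Σℤ-cong h (λ r r<h → wt-addRook m hs r p (ℕP.<-≤-trans r<h h≤max)) ⟩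
  Σℤ h (λ r → wt m hs p * (+ 1 - + (rowCount r p ℕ.* m)))     ≡⟨ Σℤ-* h (wt m hs p) _ ⟩
  wt m hs p * Σℤ h (λ r → + 1 - + (rowCount r p ℕ.* m))       ≡⟨ cong (wt m hs p *_) (Σℤ-oneMinus m h (λ r → rowCount r p)) ⟩
  wt m hs p * (+ h - + (Σℕ h (λ r → rowCount r p) ℕ.* m))     ≡⟨ cong (λ z → wt m hs p * (+ h - + (z ℕ.* m))) (Σℕ-rowCount h p below) ⟩
  wt m hs p * (+ h - + (rooks p ℕ.* m))                        ∎
  where open ≡-Reasoning

ΣPl-cong-below : ∀ H ds → All (_≤ H) ds → {f g : Placement → ℤ} →
                 (∀ p → RowsBelow H p → f p ≡ g p) → ΣPl ds f ≡ ΣPl ds g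
ΣPl-cong-below H []       _              eq = cong (_+ + 0) (eq [] tt)
ΣPl-cong-below H (h ∷ ds) (h≤H ∷ ds≤H) {f} {g} eq =
  trans (ΣPl-cons h ds f)
        (trans (ΣPl-cong-below H ds ds≤H (λ p below →
                  cong₂ _+_ (eq (nothing ∷ p) below)
                            (Σℤ-cong h (λ r r<h → eq (just r ∷ p) (ℕP.<-≤-trans r<h h≤H , below)))))
               (sym (ΣPl-cons h ds g)))

-- For the list xs of ω-entries read from the
-- right, fileSeq m xs k is f_{k,m}: the first entry x belongs to the
-- tallest column, of height |xs| m - x, which offers |xs| m - x - k m
-- weighted cells to a new rook once k rooks stand on the shorter columns.
fileSeq : ℕ → List ℤ → ℕ → ℤ
fileSeq m []       zero    = + 1
fileSeq m []       (suc k) = + 0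
fileSeq m (x ∷ xs) zero    = fileSeq m xs zero
fileSeq m (x ∷ xs) (suc k) = fileSeq m xs (suc k) + (+ (length xs ℕ.* m) - x - + (k ℕ.* m)) * fileSeq m xs k

IsOmega : ℕ → ℕ → List ℕ → List ℤ → Set
IsOmega m j []       []       = ⊤
IsOmega m j (h ∷ hs) (x ∷ xs) = (x ≡ + (j ℕ.* m) - + h) × IsOmega m (suc j) hs xs
IsOmega m j _        _        = ⊥

IsOmegaRev : ℕ → ℕ → List ℕ → List ℤ → Set
IsOmegaRev m j []       []       = ⊤
IsOmegaRev m j (h ∷ ds) (x ∷ xs) = (x ≡ + ((j ℕ.+ length xs) ℕ.* m) - + h) × IsOmegaRev m j ds xs
IsOmegaRev m j _        _        = ⊥

IsOmegaRev-snoc : ∀ m j ds xs h x → IsOmegaRev m (suc j) ds xs → x ≡ + (j ℕ.* m) - + h →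
                  IsOmegaRev m j (ds ++ h ∷ []) (xs ++ x ∷ [])
IsOmegaRev-snoc m j []       []       h x _          x≡ = subst (λ t → x ≡ + (t ℕ.* m) - + h) (sym (ℕP.+-identityʳ j)) x≡ , tt
IsOmegaRev-snoc m j (d ∷ ds) (y ∷ ys) h x (y≡ , rel) x≡ = subst (λ t → y ≡ + (t ℕ.* m) - + d) shift y≡ , IsOmegaRev-snoc m j ds ys h x rel x≡
  where
  shift : suc j ℕ.+ length ys ≡ j ℕ.+ length (ys ++ x ∷ [])
  shift = trans (sym (ℕP.+-suc j (length ys))) (cong (j ℕ.+_) (trans (ℕP.+-comm 1 (length ys)) (sym (LP.length-++ ys))))

IsOmega-reverse : ∀ m j hs xs → IsOmega m j hs xs → IsOmegaRev m j (reverse hs) (reverse xs)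
IsOmega-reverse m j []       []       _          = tt
IsOmega-reverse m j (h ∷ hs) (x ∷ xs) (x≡ , rel)
  rewrite LP.unfold-reverse h hs | LP.unfold-reverse x xs =
  IsOmegaRev-snoc m j (reverse hs) (reverse xs) h x (IsOmega-reverse m (suc j) hs xs rel) x≡

reverse-decreasing : ∀ hs → AllPairs _≤_ hs → AllPairs ℕ._≥_ (reverse hs)
reverse-decreasing []       []           = []
reverse-decreasing (h ∷ hs) (h≤ ∷ inc) rewrite LP.unfold-reverse h hs =
  AllPairsP.++⁺ (reverse-decreasing hs inc) ([] ∷ [])
                (All.map (_∷ []) (PermP.All-resp-↭ (↭-sym (PermP.↭-reverse hs)) h≤))

All-≤-maxHeight : ∀ hs → All (_≤ maxHeight hs) hs
All-≤-maxHeight []       = []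
All-≤-maxHeight (h ∷ hs) =
  ℕP.m≤m⊔n h (maxHeight hs) ∷ All.map (λ d≤ → ℕP.≤-trans d≤ (ℕP.m≤n⊔m h (maxHeight hs))) (All-≤-maxHeight hs)

addColumn-noRooks : ∀ m hs h p → addColumn h (wtWithRooks m hs 0) p ≡ wtWithRooks m hs 0 p
addColumn-noRooks m hs h p = trans (cong (_+_ (wtWithRooks m hs 0 p)) (Σℤ-zero h)) (ℤP.+-identityʳ _)

addColumn-wtWithRooks : ∀ m hs h k p → h ≤ maxHeight hs → RowsBelow h p →
  addColumn h (wtWithRooks m hs (suc k)) p ≡ wtWithRooks m hs (suc k) p + (+ h - + (k ℕ.* m)) * wtWithRooks m hs k p
addColumn-wtWithRooks m hs h k p h≤max below =
  cong (_+_ (wtWithRooks m hs (suc k) p))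
       (trans (Σℤ-cong h (λ r _ → newRook (rooks p ℕ.≟ k) r)) (total (rooks p ℕ.≟ k)))
  where
  newRook : (d : Dec (rooks p ≡ k)) → ∀ r → wtWithRooks m hs (suc k) (just r ∷ p) ≡ keepIf d (wt m hs (just r ∷ p))
  newRook d r with suc (rooks p) ℕ.≟ suc k | d
  ... | yes _ | yes _ = refl
  ... | no _  | no _  = refl
  ... | yes e | no ne = ⊥-elim (ne (ℕP.suc-injective e))
  ... | no ne | yes e = ⊥-elim (ne (cong suc e))
  total : (d : Dec (rooks p ≡ k)) → Σℤ h (λ r → keepIf d (wt m hs (just r ∷ p))) ≡ (+ h - + (k ℕ.* m)) * keepIf d (wt m hs p)
  total (yes refl) = trans (Σℤ-wt-addRook m hs h p h≤max below) (ℤP.*-comm (wt m hs p) _)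
  total (no _)     = trans (Σℤ-zero h) (sym (ℤP.*-zeroʳ (+ h - + (k ℕ.* m))))

ΣPl-fileSeq : ∀ m hs ds xs → AllPairs ℕ._≥_ ds → All (_≤ maxHeight hs) ds → IsOmegaRev m 0 ds xs →
              ∀ k → ΣPl ds (wtWithRooks m hs k) ≡ fileSeq m xs k
ΣPl-fileSeq m hs []       []       _ _ _ zero    = cong (_+ + 0) (wt-empty m hs)
ΣPl-fileSeq m hs []       []       _ _ _ (suc k) = refl
ΣPl-fileSeq m hs (h ∷ ds) (x ∷ xs) (_ ∷ dec) (_ ∷ ds≤) (_ , rel) zero =
  trans (ΣPl-cons h ds _) (trans (ΣPl-cong ds (addColumn-noRooks m hs h)) (ΣPl-fileSeq m hs ds xs dec ds≤ rel zero))
ΣPl-fileSeq m hs (h ∷ ds) (x ∷ xs) (ds≤h ∷ dec) (h≤max ∷ ds≤) (x≡ , rel) (suc k) = begin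
  ΣPl (h ∷ ds) (wtWithRooks m hs (suc k))
    ≡⟨ ΣPl-cons h ds _ ⟩
  ΣPl ds (addColumn h (wtWithRooks m hs (suc k)))
    ≡⟨ ΣPl-cong-below h ds ds≤h (λ p below → addColumn-wtWithRooks m hs h k p h≤max below) ⟩
  ΣPl ds (λ p → wtWithRooks m hs (suc k) p + c * wtWithRooks m hs k p)
    ≡⟨ sumℤ-map-+ _ _ (placements ds) ⟩
  ΣPl ds (wtWithRooks m hs (suc k)) + ΣPl ds (λ p → c * wtWithRooks m hs k p)
    ≡⟨ cong (_+_ (ΣPl ds (wtWithRooks m hs (suc k)))) (sumℤ-map-* c _ (placements ds)) ⟩
  ΣPl ds (wtWithRooks m hs (suc k)) + c * ΣPl ds (wtWithRooks m hs k)
    ≡⟨ cong₂ (λ u v → u + c * v) (ΣPl-fileSeq m hs ds xs dec ds≤ rel (suc k)) (ΣPl-fileSeq m hs ds xs dec ds≤ rel k) ⟩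
  fileSeq m xs (suc k) + c * fileSeq m xs k
    ≡⟨ cong (λ t → fileSeq m xs (suc k) + t * fileSeq m xs k) c≡ ⟩
  fileSeq m (x ∷ xs) (suc k) ∎
  where
  open ≡-Reasoning
  c : ℤ
  c = + h - + (k ℕ.* m)
  c≡ : c ≡ + (length xs ℕ.* m) - x - + (k ℕ.* m)
  c≡ rewrite x≡ = regroup (+ (length xs ℕ.* m)) (+ h) (+ (k ℕ.* m))
    where
    regroup : ∀ a b d → b - d ≡ a - (a - b) - d
    regroup = solve-∀

fileNum-fileSeq : ∀ k m {N} (b : Vec ℕ N) (xs : List ℤ) → AllPairs _≤_ (toList b) → IsOmega m 0 (toList b) xs →
                  fileNum k m b ≡ fileSeq m (reverse xs) k
fileNum-fileSeq k m b xs inc isω = begin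
  fileNum k m b                                              ≡⟨ fileNum-ΣPl k m b ⟩
  ΣPl (toList b) (wtWithRooks m (toList b) k)
    ≡⟨ ΣPl-↭ (↭-sym (PermP.↭-reverse (toList b))) _ (wtWithRooks-swapInvariant m (toList b) k) ⟩
  ΣPl (reverse (toList b)) (wtWithRooks m (toList b) k)
    ≡⟨ ΣPl-fileSeq m (toList b) (reverse (toList b)) (reverse xs) (reverse-decreasing (toList b) inc)
         (PermP.All-resp-↭ (↭-sym (PermP.↭-reverse (toList b))) (All-≤-maxHeight (toList b)))
         (IsOmega-reverse m 0 (toList b) xs isω) k ⟩
  fileSeq m (reverse xs) k                                   ∎
  where open ≡-Reasoning

module _ (m : ℕ) where

  fileSeq-↭ : ∀ {xs ys} → xs ↭ ys → ∀ k → fileSeq m xs k ≡ fileSeq m ys k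
  fileSeq-↭ Perm.refl k = refl
  fileSeq-↭ {x ∷ xs} {x ∷ ys} (Perm.prep x σ) zero = fileSeq-↭ σ zero
  fileSeq-↭ {x ∷ xs} {x ∷ ys} (Perm.prep x σ) (suc k) rewrite PermP.↭-length σ =
    cong₂ _+_ (fileSeq-↭ σ (suc k)) (cong ((+ (length ys ℕ.* m) - x - + (k ℕ.* m)) *_) (fileSeq-↭ σ k))
  fileSeq-↭ {x ∷ y ∷ xs} {y ∷ x ∷ ys} (Perm.swap x y σ) zero = fileSeq-↭ σ zero
  fileSeq-↭ {x ∷ y ∷ xs} {y ∷ x ∷ ys} (Perm.swap x y σ) (suc zero)
    rewrite PermP.↭-length σ | fileSeq-↭ σ 0 | fileSeq-↭ σ 1 | ℤP.pos-+ m (length ys ℕ.* m) =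
    swapLaw (fileSeq m ys 1) (fileSeq m ys 0) (+ (length ys ℕ.* m)) (+ m) x y
    where
    swapLaw : ∀ g1 g0 A M x y →
      g1 + (A - y - + 0) * g0 + (M + A - x - + 0) * g0 ≡ g1 + (A - x - + 0) * g0 + (M + A - y - + 0) * g0
    swapLaw = solve-∀
  fileSeq-↭ {x ∷ y ∷ xs} {y ∷ x ∷ ys} (Perm.swap x y σ) (suc (suc k))
    rewrite PermP.↭-length σ | fileSeq-↭ σ k | fileSeq-↭ σ (suc k) | fileSeq-↭ σ (suc (suc k))
          | ℤP.pos-+ m (length ys ℕ.* m) | ℤP.pos-+ m (k ℕ.* m) =
    swapLaw (fileSeq m ys (suc (suc k))) (fileSeq m ys (suc k)) (fileSeq m ys k)
            (+ (length ys ℕ.* m)) (+ (k ℕ.* m)) (+ m) x y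
    where
    swapLaw : ∀ g2 g1 g0 A K M x y →
      g2 + (A - y - (M + K)) * g1 + (M + A - x - (M + K)) * (g1 + (A - y - K) * g0)
      ≡ g2 + (A - x - (M + K)) * g1 + (M + A - y - (M + K)) * (g1 + (A - x - K) * g0)
    swapLaw = solve-∀
  fileSeq-↭ (Perm.trans σ τ) k = trans (fileSeq-↭ σ k) (fileSeq-↭ τ k)

  fileSeq-cancel : ∀ x xs ys → length xs ≡ length ys →
                   (∀ k → fileSeq m (x ∷ xs) k ≡ fileSeq m (x ∷ ys) k) → ∀ k → fileSeq m xs k ≡ fileSeq m ys k
  fileSeq-cancel x xs ys len eq zero    = eq zero
  fileSeq-cancel x xs ys len eq (suc k) =
    +-cancelʳℤ _ _ _ (trans (eq (suc k))
      (cong₂ (λ u v → fileSeq m ys (suc k) + (+ (u ℕ.* m) - x - + (k ℕ.* m)) * v) (sym len) (sym (fileSeq-cancel x xs ys len eq k))))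

  -- There are no placements with more rooks than columns.
  fileSeq-vanish : ∀ xs k → length xs < k → fileSeq m xs k ≡ + 0
  fileSeq-vanish []       (suc k) _ = refl
  fileSeq-vanish (x ∷ xs) (suc k) (s≤s len<k) =
    trans (cong₂ (λ u v → u + (+ (length xs ℕ.* m) - x - + (k ℕ.* m)) * v)
                 (fileSeq-vanish xs (suc k) (ℕP.m<n⇒m<1+n len<k)) (fileSeq-vanish xs k len<k))
          (trans (ℤP.+-identityˡ _) (ℤP.*-zeroʳ (+ (length xs ℕ.* m) - x - + (k ℕ.* m))))

  -- Σanti n f = Σ_{k + r = n} f k r.
  Σanti : ℕ → (ℕ → ℕ → ℤ) → ℤ
  Σanti zero    f = f 0 0
  Σanti (suc n) f = f 0 (suc n) + Σanti n (λ k r → f (suc k) r)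

  Σanti-peel : ∀ n f → Σanti (suc n) f ≡ Σanti n (λ k r → f k (suc r)) + f (suc n) 0
  Σanti-peel zero    f = refl
  Σanti-peel (suc n) f =
    trans (cong (_+_ (f 0 (suc (suc n)))) (Σanti-peel n (λ k r → f (suc k) r)))
          (sym (ℤP.+-assoc (f 0 (suc (suc n))) (Σanti n (λ k r → f (suc k) (suc r))) (f (suc (suc n)) 0)))

  Σanti-cong : ∀ n {f g : ℕ → ℕ → ℤ} → (∀ k r → k ℕ.+ r ≡ n → f k r ≡ g k r) → Σanti n f ≡ Σanti n g
  Σanti-cong zero    eq = eq 0 0 refl
  Σanti-cong (suc n) eq = cong₂ _+_ (eq 0 (suc n) refl) (Σanti-cong n (λ k r e → eq (suc k) r (cong suc e)))

  Σanti-+ : ∀ n f g → Σanti n (λ k r → f k r + g k r) ≡ Σanti n f + Σanti n g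
  Σanti-+ zero    f g = refl
  Σanti-+ (suc n) f g =
    trans (cong (_+_ (f 0 (suc n) + g 0 (suc n))) (Σanti-+ n (λ k r → f (suc k) r) (λ k r → g (suc k) r)))
          (+-interchangeℤ (f 0 (suc n)) (g 0 (suc n)) _ _)

  Σanti-* : ∀ n c f → Σanti n (λ k r → c * f k r) ≡ c * Σanti n f
  Σanti-* zero    c f = refl
  Σanti-* (suc n) c f =
    trans (cong (_+_ (c * f 0 (suc n))) (Σanti-* n c (λ k r → f (suc k) r)))
          (sym (ℤP.*-distribˡ-+ c (f 0 (suc n)) _))

  fallingSum : List ℤ → ℤ → ℤ
  fallingSum xs z = Σanti (length xs) (λ k r → fileSeq m xs k * fall z r m)

  -- As fileSeq_{n+1}(xs) = 0 for n = |xs|, the falling factorials may be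
  -- shifted by one.
  fallingSum-shift : ∀ xs z → Σanti (suc (length xs)) (λ k r → fileSeq m xs k * fall z r m)
                            ≡ Σanti (length xs) (λ k r → fileSeq m xs k * fall z (suc r) m)
  fallingSum-shift xs z = begin
      Σanti (suc n) (λ k r → g k * F r)
    ≡⟨ Σanti-peel n (λ k r → g k * F r) ⟩
      Σanti n (λ k r → g k * F (suc r)) + g (suc n) * F 0
    ≡⟨ cong (λ u → Σanti n (λ k r → g k * F (suc r)) + u * F 0) (fileSeq-vanish xs (suc n) (ℕP.n<1+n n)) ⟩
      Σanti n (λ k r → g k * F (suc r)) + + 0 * F 0
    ≡⟨ cong (_+_ (Σanti n (λ k r → g k * F (suc r)))) (ℤP.*-zeroˡ (F 0)) ⟩
      Σanti n (λ k r → g k * F (suc r)) + + 0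
    ≡⟨ ℤP.+-identityʳ _ ⟩
      Σanti n (λ k r → g k * F (suc r))
    ∎
    where
    open ≡-Reasoning
    n : ℕ
    n = length xs
    g : ℕ → ℤ
    g = fileSeq m xs
    F : ℕ → ℤ
    F r = fall z r m

  fallingSum-cons : ∀ x xs z → fallingSum (x ∷ xs) z ≡ (z - x) * fallingSum xs z
  fallingSum-cons x xs z = begin
      g 0 * F (suc n) + Σanti n (λ k r → (g (suc k) + t k * g k) * F r)
    ≡⟨ cong (_+_ (g 0 * F (suc n))) (trans (Σanti-cong n (λ k r _ → ℤP.*-distribʳ-+ (F r) (g (suc k)) (t k * g k)))
                                           (Σanti-+ n (λ k r → g (suc k) * F r) (λ k r → t k * g k * F r))) ⟩
      g 0 * F (suc n) + (Σanti n (λ k r → g (suc k) * F r) + Σanti n (λ k r → t k * g k * F r))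
    ≡⟨ sym (ℤP.+-assoc (g 0 * F (suc n)) _ _) ⟩
      Σanti (suc n) (λ k r → g k * F r) + Σanti n (λ k r → t k * g k * F r)
    ≡⟨ cong (_+ Σanti n (λ k r → t k * g k * F r)) (fallingSum-shift xs z) ⟩
      Σanti n (λ k r → g k * F (suc r)) + Σanti n (λ k r → t k * g k * F r)
    ≡⟨ sym (Σanti-+ n (λ k r → g k * F (suc r)) (λ k r → t k * g k * F r)) ⟩
      Σanti n (λ k r → g k * F (suc r) + t k * g k * F r)
    ≡⟨ Σanti-cong n termwise ⟩
      Σanti n (λ k r → (z - x) * (g k * F r))
    ≡⟨ Σanti-* n (z - x) (λ k r → g k * F r) ⟩
      (z - x) * fallingSum xs z
    ∎
    where
    open ≡-Reasoning
    n : ℕ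
    n = length xs
    g : ℕ → ℤ
    g = fileSeq m xs
    F : ℕ → ℤ
    F r = fall z r m
    t : ℕ → ℤ
    t k = + (n ℕ.* m) - x - + (k ℕ.* m)
    -- z↓_{r+1} = z↓_r (z - r m), and t k + (z - r m) = z - x when k + r = n.
    termwise : ∀ k r → k ℕ.+ r ≡ n → g k * F (suc r) + t k * g k * F r ≡ (z - x) * (g k * F r)
    termwise k r k+r≡n rewrite sym k+r≡n | ℕP.*-distribʳ-+ m k r | ℤP.pos-+ (k ℕ.* m) (r ℕ.* m) =
      collect (g k) (F r) (+ (k ℕ.* m)) (+ (r ℕ.* m)) z x
      where
      collect : ∀ a f K R z x → a * (f * (z - R)) + (K + R - x - K) * a * f ≡ (z - x) * (a * f)
      collect = solve-∀

  factorization : ∀ xs z → fallingSum xs z ≡ List.foldr _*_ (+ 1) (map (_-_ z) xs)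
  factorization []       z = refl
  factorization (x ∷ xs) z = trans (fallingSum-cons x xs z) (cong ((z - x) *_) (factorization xs z))

  fallingSum-cong : ∀ xs ys z → length xs ≡ length ys → (∀ k → fileSeq m xs k ≡ fileSeq m ys k) →
                    fallingSum xs z ≡ fallingSum ys z
  fallingSum-cong xs ys z len eq rewrite len = Σanti-cong (length ys) (λ k r _ → cong (_* fall z r m) (eq k))

  root-∈ : ∀ z ys → List.foldr _*_ (+ 1) (map (_-_ z) ys) ≡ + 0 → z ∈ ys
  root-∈ z []       ()
  root-∈ z (y ∷ ys) e with ℤP.i*j≡0⇒i≡0∨j≡0 (z - y) e
  ... | inj₁ z-y≡0 = here (ℤP.i-j≡0⇒i≡j z y z-y≡0)
  ... | inj₂ rest≡0 = there (root-∈ z ys rest≡0)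

  fileSeq-injective : ∀ xs ys → length xs ≡ length ys → (∀ k → fileSeq m xs k ≡ fileSeq m ys k) → xs ↭ ys
  fileSeq-injective []       []  _   _  = Perm.refl
  fileSeq-injective (x ∷ xs) ys len eq with ∈-∃++ (root-∈ x ys x-isRoot)
    where
    x-isRoot : List.foldr _*_ (+ 1) (map (_-_ x) ys) ≡ + 0
    x-isRoot = begin
      List.foldr _*_ (+ 1) (map (_-_ x) ys)  ≡⟨ factorization ys x ⟨
      fallingSum ys x                        ≡⟨ fallingSum-cong (x ∷ xs) ys x len eq ⟨
      fallingSum (x ∷ xs) x                  ≡⟨ fallingSum-cons x xs x ⟩
      (x - x) * fallingSum xs x              ≡⟨ cong (_* fallingSum xs x) (ℤP.+-inverseʳ x) ⟩
      + 0                                    ∎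
      where open ≡-Reasoning
  ... | as , bs , refl = ↭-trans (Perm.prep x (fileSeq-injective xs (as ++ bs) len′ eq′)) (↭-sym (PermP.shift x as bs))
    where
    len′ : length xs ≡ length (as ++ bs)
    len′ = ℕP.suc-injective (trans len (trans (LP.length-++ as) (trans (ℕP.+-suc (length as) (length bs)) (cong suc (sym (LP.length-++ as))))))
    eq′ : ∀ k → fileSeq m xs k ≡ fileSeq m (as ++ bs) k
    eq′ = fileSeq-cancel x xs (as ++ bs) len′ (λ k → trans (eq k) (fileSeq-↭ (PermP.shift x as bs) k))

pairSum : (ℤ → ℤ → ℕ) → List ℤ → ℕ
pairSum f []       = 0
pairSum f (a ∷ as) = sum (map (f a) as) ℕ.+ pairSum f as

length-filter : ∀ (p : ℤ → Bool) as → length (filter (λ x → T? (p x)) as) ≡ sum (map (bit ∘ p) as)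
length-filter p []       = refl
length-filter p (b ∷ as) with p b
... | true  = cong suc (length-filter p as)
... | false = length-filter p as

pairCount-pairSum : ∀ m k π → pairCount m k π ≡ pairSum (λ a b → bit (cond? m k a b)) π
pairCount-pairSum m k []       = refl
pairCount-pairSum m k (a ∷ as) = cong₂ ℕ._+_ (length-filter (cond? m k a) as) (pairCount-pairSum m k as)

Σℕ-sum : ∀ n (f : ℕ → ℤ → ℕ) (L : List ℤ) → Σℕ n (λ k → sum (map (f k) L)) ≡ sum (map (λ b → Σℕ n (λ k → f k b)) L)
Σℕ-sum zero    f []      = refl
Σℕ-sum zero    f (b ∷ L) = Σℕ-sum zero f L
Σℕ-sum (suc n) f L =
  trans (cong (sum (map (f 0) L) ℕ.+_) (Σℕ-sum n (f ∘ suc) L)) (sym (sum-map-+ (f 0) (λ b → Σℕ n (λ k → f (suc k) b)) L))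

Σℕ-pairSum : ∀ n (f : ℕ → ℤ → ℤ → ℕ) xs → Σℕ n (λ k → pairSum (f k) xs) ≡ pairSum (λ a b → Σℕ n (λ k → f k a b)) xs
Σℕ-pairSum n f []       = Σℕ-zero n
Σℕ-pairSum n f (a ∷ as) =
  trans (Σℕ-+ n (λ k → sum (map (f k a) as)) (λ k → pairSum (f k) as))
        (cong₂ ℕ._+_ (Σℕ-sum n (λ k → f k a) as) (Σℕ-pairSum n f as))

pairSum-+ : ∀ (f g : ℤ → ℤ → ℕ) xs → pairSum (λ a b → f a b ℕ.+ g a b) xs ≡ pairSum f xs ℕ.+ pairSum g xs
pairSum-+ f g []       = refl
pairSum-+ f g (a ∷ as) =
  trans (cong₂ ℕ._+_ (sum-map-+ (f a) (g a) as) (pairSum-+ f g as))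
        (+-interchangeℕ (sum (map (f a) as)) (sum (map (g a) as)) (pairSum f as) (pairSum g as))

dinvWeight : ℕ → ℤ → ℤ → ℕ
dinvWeight m a b = Σℕ m (λ k → bit (cond? m k a b))

dinvSeq-pairSum : ∀ m π → dinvSeq m π ≡ pairSum (dinvWeight m) π
dinvSeq-pairSum m π = begin
  dinvSeq m π                                             ≡⟨ sum-applyUpTo m (λ k → pairCount m k π) (λ k → k) ⟩
  Σℕ m (λ k → pairCount m k π)                            ≡⟨ Σℕ-cong m (λ k _ → pairCount-pairSum m k π) ⟩
  Σℕ m (λ k → pairSum (λ a b → bit (cond? m k a b)) π)    ≡⟨ Σℕ-pairSum m (λ k a b → bit (cond? m k a b)) π ⟩
  pairSum (dinvWeight m) π                                 ∎
  where open ≡-Reasoning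

pairSum-↭ : ∀ (f : ℤ → ℤ → ℕ) → (∀ a b → f a b ≡ f b a) → ∀ {xs ys} → xs ↭ ys → pairSum f xs ≡ pairSum f ys
pairSum-↭ f sym-f Perm.refl = refl
pairSum-↭ f sym-f {x ∷ xs} {x ∷ ys} (Perm.prep x σ) =
  cong₂ ℕ._+_ (sum-↭ (PermP.map⁺ (f x) σ)) (pairSum-↭ f sym-f σ)
pairSum-↭ f sym-f {x ∷ y ∷ xs} {y ∷ x ∷ ys} (Perm.swap x y σ)
  rewrite sum-↭ (PermP.map⁺ (f x) σ) | sum-↭ (PermP.map⁺ (f y) σ) | pairSum-↭ f sym-f σ | sym-f x y =
  +-interchangeℕ (f y x) (sum (map (f x) ys)) (sum (map (f y) ys)) (pairSum f ys)
pairSum-↭ f sym-f (Perm.trans σ τ) = trans (pairSum-↭ f sym-f σ) (pairSum-↭ f sym-f τ)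

pairSum-insert : ∀ f pre z post →
  pairSum f (pre ++ z ∷ post) ≡ pairSum f (pre ++ post) ℕ.+ sum (map (λ x → f x z) pre) ℕ.+ sum (map (f z) post)
pairSum-insert f []        z post =
  trans (ℕP.+-comm (sum (map (f z) post)) (pairSum f post))
        (cong (ℕ._+ sum (map (f z) post)) (sym (ℕP.+-identityʳ (pairSum f post))))
pairSum-insert f (x ∷ pre) z post
  rewrite pairSum-insert f pre z post | LP.map-++ (f x) pre (z ∷ post) | LP.map-++ (f x) pre post
        | sum-++ (map (f x) pre) (map (f x) (z ∷ post)) | sum-++ (map (f x) pre) (map (f x) post) =
  regroup (sum (map (f x) pre)) (f x z) (sum (map (f x) post)) (pairSum f (pre ++ post))
          (sum (map (λ y → f y z) pre)) (sum (map (f z) post))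
  where
  regroup : ∀ a b c d g h → a ℕ.+ (b ℕ.+ c) ℕ.+ (d ℕ.+ g ℕ.+ h) ≡ a ℕ.+ c ℕ.+ d ℕ.+ (b ℕ.+ g) ℕ.+ h
  regroup = solveℕ

-- With d = a - b, dinvWeight m b a
-- counts the j < m in the window [d, d + m], dinvWeight m a b counts the
-- j ∈ [1, m] in it, and the two end points j = 0 and j = m of the window
-- account for the m-ascent or m-descent formed by (a, b).

between : ℤ → ℤ → ℤ → ℕ
between lo hi t = bit ⌊ (lo ℤ.≤? t) ×-dec (t ℤ.≤? hi) ⌋

between-cong : ∀ {lo hi t lo′ hi′ t′} → lo ≡ lo′ → hi ≡ hi′ → t ≡ t′ → between lo hi t ≡ between lo′ hi′ t′
between-cong refl refl refl = refl

between-shift : ∀ c lo hi t → between lo hi t ≡ between (lo + c) (hi + c) (t + c)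
between-shift c lo hi t =
  bit-⇔ (λ (p , q) → ℤP.+-monoˡ-≤ c p , ℤP.+-monoˡ-≤ c q) (λ (p , q) → unshift p , unshift q) _ _
  where
  cancel : ∀ a c → a + c + - c ≡ a
  cancel = solve-∀
  unshift : ∀ {a b} → a + c ℤ.≤ b + c → a ℤ.≤ b
  unshift {a} {b} le = subst₂ ℤ._≤_ (cancel a c) (cancel b c) (ℤP.+-monoˡ-≤ (- c) le)

between-reflect : ∀ c lo hi t → between lo hi t ≡ between (c - hi) (c - lo) (c - t)
between-reflect c lo hi t =
  trans (bit-⇔ (λ (p , q) → ℤP.neg-mono-≤ q , ℤP.neg-mono-≤ p) (λ (p , q) → ℤP.neg-cancel-≤ q , ℤP.neg-cancel-≤ p) _ _)
        (trans (between-shift c (- hi) (- lo) (- t))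
               (between-cong (ℤP.+-comm (- hi) c) (ℤP.+-comm (- lo) c) (ℤP.+-comm (- t) c)))

between-yes : ∀ lo hi t → lo ℤ.≤ t → t ℤ.≤ hi → between lo hi t ≡ 1
between-yes lo hi t p q = bit-yes (p , q) ((lo ℤ.≤? t) ×-dec (t ℤ.≤? hi))

between-no : ∀ lo hi t → ¬ (lo ℤ.≤ t × t ℤ.≤ hi) → between lo hi t ≡ 0
between-no lo hi t out = bit-no out ((lo ℤ.≤? t) ×-dec (t ℤ.≤? hi))

between-split : ∀ lo hi t → lo ℤ.≤ hi → between lo hi t ≡ between lo lo t ℕ.+ between (ℤ.suc lo) hi t
between-split lo hi t lo≤hi with ℤP.<-cmp t lo
... | tri< t<lo _ _ = trans (between-no lo hi t below)
                            (sym (cong₂ ℕ._+_ (between-no lo lo t below) (between-no (ℤ.suc lo) hi t (below ∘ raise))))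
  where
  below : ∀ {u} → ¬ (lo ℤ.≤ t × t ℤ.≤ u)
  below (p , _) = ℤP.<⇒≱ t<lo p
  raise : ∀ {u} → ℤ.suc lo ℤ.≤ t × t ℤ.≤ u → lo ℤ.≤ t × t ℤ.≤ u
  raise (p , q) = ℤP.≤-trans (ℤP.i≤suc[i] lo) p , q
... | tri≈ _ refl _ = trans (between-yes lo hi lo ℤP.≤-refl lo≤hi)
                            (sym (cong₂ ℕ._+_ (between-yes lo lo lo ℤP.≤-refl ℤP.≤-refl)
                                              (between-no (ℤ.suc lo) hi lo (λ (p , _) → ℤP.<-irrefl refl (ℤP.suc[i]≤j⇒i<j p)))))
... | tri> _ _ lo<t = trans (bit-⇔ (λ (_ , q) → ℤP.i<j⇒suc[i]≤j lo<t , q) (λ (_ , q) → ℤP.<⇒≤ lo<t , q) _ _)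
                            (sym (cong (ℕ._+ between (ℤ.suc lo) hi t) (between-no lo lo t (λ (_ , q) → ℤP.<⇒≱ lo<t q))))

module _ (m : ℕ) where

  stepDown : ℤ → ℤ → ℕ
  stepDown a b = between (+ 1) (+ m) (a - b)

  same : ℤ → ℤ → ℕ
  same a b = between (+ 0) (+ 0) (a - b)

  same-sym : ∀ a b → same a b ≡ same b a
  same-sym a b = trans (between-reflect (+ 0) (+ 0) (+ 0) (a - b)) (between-cong refl refl (negate a b))
    where
    negate : ∀ a b → + 0 - (a - b) ≡ b - a
    negate = solve-∀

  window : ℤ → ℤ → ℕ → ℕ
  window a b j = between (a - b) (a - b + + m) (+ j)

  cond-reversed : ∀ a b j → j < m → bit (cond? m (m ∸ suc j) a b) ≡ window a b (suc j)
  cond-reversed a b j j<m = trans (between-reflect (a - b + + m) (+ 0) (+ m) (a - b + + k))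
                                  (between-cong (cancelM (a - b) (+ m)) (ℤP.+-identityʳ (a - b + + m)) complement)
    where
    k : ℕ
    k = m ∸ suc j
    cancelM : ∀ d M → d + M - M ≡ d
    cancelM = solve-∀
    k+j : + k + + suc j ≡ + m
    k+j = trans (sym (ℤP.pos-+ k (suc j))) (cong +_ (ℕP.m∸n+n≡m j<m))
    complement : a - b + + m - (a - b + + k) ≡ + suc j
    complement = trans (cong (λ M → a - b + M - (a - b + + k)) (sym k+j)) (leave (a - b) (+ k) (+ suc j))
      where
      leave : ∀ d K J → d + (K + J) - (d + K) ≡ J
      leave = solve-∀

  dinvWeight-window : ∀ a b → dinvWeight m a b ≡ Σℕ m (λ j → window a b (suc j))
  dinvWeight-window a b =
    trans (Σℕ-reverse m (λ k → bit (cond? m k a b))) (Σℕ-cong m (λ j j<m → cond-reversed a b j j<m))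

  dinvWeight-window′ : ∀ a b → dinvWeight m b a ≡ Σℕ m (window a b)
  dinvWeight-window′ a b = Σℕ-cong m (λ k _ →
    trans (between-shift (a - b) (+ 0) (+ m) (b - a + + k))
          (between-cong (ℤP.+-identityˡ (a - b)) (ℤP.+-comm (+ m) (a - b)) (cancel a b (+ k))))
    where
    cancel : ∀ a b K → b - a + K + (a - b) ≡ K
    cancel = solve-∀

  window-zero : ∀ a b → window a b 0 ≡ same b a ℕ.+ stepDown b a
  window-zero a b =
    trans (between-shift (b - a) (a - b) (a - b + + m) (+ 0))
          (trans (between-cong (cancel a b) (cancel′ a b (+ m)) (ℤP.+-identityˡ (b - a)))
                 (between-split (+ 0) (+ m) (b - a) (ℤ.+≤+ z≤n)))
    where
    cancel : ∀ a b → a - b + (b - a) ≡ + 0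
    cancel = solve-∀
    cancel′ : ∀ a b M → a - b + M + (b - a) ≡ M
    cancel′ = solve-∀

  window-m : ∀ a b → window a b m ≡ same a b ℕ.+ stepDown a b
  window-m a b =
    trans (between-reflect (a - b + + m) (a - b) (a - b + + m) (+ m))
          (trans (between-cong (ℤP.+-inverseʳ (a - b + + m)) (cancel (a - b) (+ m)) (cancel′ (a - b) (+ m)))
                 (between-split (+ 0) (+ m) (a - b) (ℤ.+≤+ z≤n)))
    where
    cancel : ∀ d M → d + M - d ≡ M
    cancel = solve-∀
    cancel′ : ∀ d M → d + M - M ≡ d
    cancel′ = solve-∀

  exchange : ∀ a b → dinvWeight m a b ℕ.+ stepDown b a ≡ dinvWeight m b a ℕ.+ stepDown a b
  exchange a b = ℕP.+-cancelʳ-≡ (same a b) _ _ (begin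
      dinvWeight m a b ℕ.+ stepDown b a ℕ.+ same a b
    ≡⟨ cong (λ s → dinvWeight m a b ℕ.+ stepDown b a ℕ.+ s) (same-sym a b) ⟩
      dinvWeight m a b ℕ.+ stepDown b a ℕ.+ same b a
    ≡⟨ trans (ℕP.+-assoc (dinvWeight m a b) _ _) (cong (dinvWeight m a b ℕ.+_) (ℕP.+-comm (stepDown b a) _)) ⟩
      dinvWeight m a b ℕ.+ (same b a ℕ.+ stepDown b a)
    ≡⟨ cong₂ ℕ._+_ (dinvWeight-window a b) (sym (window-zero a b)) ⟩
      Σℕ m (λ j → window a b (suc j)) ℕ.+ window a b 0
    ≡⟨ Σℕ-shift m (window a b) ⟩
      Σℕ m (window a b) ℕ.+ window a b m
    ≡⟨ cong₂ ℕ._+_ (sym (dinvWeight-window′ a b)) (window-m a b) ⟩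
      dinvWeight m b a ℕ.+ (same a b ℕ.+ stepDown a b)
    ≡⟨ trans (cong (dinvWeight m b a ℕ.+_) (ℕP.+-comm (same a b) _)) (sym (ℕP.+-assoc (dinvWeight m b a) _ _)) ⟩
      dinvWeight m b a ℕ.+ stepDown a b ℕ.+ same a b
    ∎)
    where open ≡-Reasoning

≤-by-difference : ∀ {a b c d} → c - d ≡ a - b → d ℤ.≤ c → b ℤ.≤ a
≤-by-difference c-d≡a-b d≤c = ℤP.0≤i-j⇒j≤i (subst (+ 0 ℤ.≤_) c-d≡a-b (ℤP.i≤j⇒0≤j-i d≤c))

StartsAtZero : List ℤ → Set
StartsAtZero []      = ⊤
StartsAtZero (x ∷ _) = x ≡ + 0

module _ (m : ℕ) where

  Step : ℤ → ℤ → Set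
  Step x y = y ℤ.≤ x + + m

  Admissible : List ℤ → Set
  Admissible xs = StartsAtZero xs × All (+ 0 ℤ.≤_) xs × Linked Step xs

  omega : ∀ {N} → Vec ℕ N → List ℤ
  omega b = toList (ωm m b)

  length-omega : ∀ {N} (b : Vec ℕ N) → length (omega b) ≡ N
  length-omega b = VecP.length-toList (ωm m b)

  Fits : ℕ → List ℕ → Set
  Fits j []       = ⊤
  Fits j (h ∷ hs) = h ≤ j ℕ.* m × Fits (suc j) hs

  fits⇒Fits : ∀ {n} j (v : Vec ℕ n) → (∀ i → lookup v i ≤ (j ℕ.+ toℕ i) ℕ.* m) → Fits j (toList v)
  fits⇒Fits j Vec.[]      f = tt
  fits⇒Fits j (h Vec.∷ v) f =
    subst (λ t → h ≤ t ℕ.* m) (ℕP.+-identityʳ j) (f Fin.zero) ,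
    fits⇒Fits (suc j) v (λ i → subst (λ t → lookup v i ≤ t ℕ.* m) (ℕP.+-suc j (toℕ i)) (f (Fin.suc i)))

  Fits⇒fits : ∀ {n} j (v : Vec ℕ n) → Fits j (toList v) → ∀ i → lookup v i ≤ (j ℕ.+ toℕ i) ℕ.* m
  Fits⇒fits j (h Vec.∷ v) (h≤ , _) Fin.zero    = subst (λ t → h ≤ t ℕ.* m) (sym (ℕP.+-identityʳ j)) h≤
  Fits⇒fits j (h Vec.∷ v) (_ , fs) (Fin.suc i) =
    subst (λ t → lookup v i ≤ t ℕ.* m) (sym (ℕP.+-suc j (toℕ i))) (Fits⇒fits (suc j) v fs i)

  IsOmega-omega : ∀ {N} (b : Vec ℕ N) → IsOmega m 0 (toList b) (omega b)
  IsOmega-omega b = tabulated 0 b _ (λ i → refl)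
    where
    tabulated : ∀ {n} j (v : Vec ℕ n) (f : Fin n → ℤ) → (∀ i → f i ≡ + ((j ℕ.+ toℕ i) ℕ.* m) - + lookup v i) →
                IsOmega m j (toList v) (toList (Vec.tabulate f))
    tabulated j Vec.[]      f eq = tt
    tabulated j (h Vec.∷ v) f eq =
      subst (λ t → f Fin.zero ≡ + (t ℕ.* m) - + h) (ℕP.+-identityʳ j) (eq Fin.zero) ,
      tabulated (suc j) v (f ∘ Fin.suc)
        (λ i → trans (eq (Fin.suc i)) (cong (λ t → + (t ℕ.* m) - + lookup v i) (ℕP.+-suc j (toℕ i))))

  IsOmega-unique : ∀ j hs xs ys → IsOmega m j hs xs → IsOmega m j hs ys → xs ≡ ys
  IsOmega-unique j []       []       []       _         _         = refl
  IsOmega-unique j (h ∷ hs) (x ∷ xs) (y ∷ ys) (x≡ , ωx) (y≡ , ωy) =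
    cong₂ _∷_ (trans x≡ (sym y≡)) (IsOmega-unique (suc j) hs xs ys ωx ωy)

  IsOmega-heights-unique : ∀ j hs hs′ xs → IsOmega m j hs xs → IsOmega m j hs′ xs → hs ≡ hs′
  IsOmega-heights-unique j []       []         []       _          _          = refl
  IsOmega-heights-unique j (h ∷ hs) (h′ ∷ hs′) (x ∷ xs) (x≡ , ωhs) (x≡′ , ωhs′) =
    cong₂ _∷_ (ℤP.+-injective (begin
                 + h                                ≡⟨ recover (+ (j ℕ.* m)) (+ h) ⟩
                 + (j ℕ.* m) - (+ (j ℕ.* m) - + h)  ≡⟨ cong (_-_ (+ (j ℕ.* m))) (trans (sym x≡) x≡′) ⟩
                 + (j ℕ.* m) - (+ (j ℕ.* m) - + h′) ≡⟨ recover (+ (j ℕ.* m)) (+ h′) ⟨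
                 + h′                               ∎))
              (IsOmega-heights-unique (suc j) hs hs′ xs ωhs ωhs′)
    where
    open ≡-Reasoning
    recover : ∀ J H → H ≡ J - (J - H)
    recover = solve-∀

  monotone⇒sorted : ∀ {n} (v : Vec ℕ n) → (∀ i j → toℕ i ≤ toℕ j → lookup v i ≤ lookup v j) → AllPairs _≤_ (toList v)
  monotone⇒sorted Vec.[]      _    = []
  monotone⇒sorted (h Vec.∷ v) mono =
    VecAllP.toList⁺ (VecAllP.lookup⁻ (λ j → mono Fin.zero (Fin.suc j) z≤n)) ∷
    monotone⇒sorted v (λ i j i≤j → mono (Fin.suc i) (Fin.suc j) (s≤s i≤j))

  sorted⇒monotone : ∀ {n} (v : Vec ℕ n) → AllPairs _≤_ (toList v) → ∀ i j → toℕ i ≤ toℕ j → lookup v i ≤ lookup v j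
  sorted⇒monotone (h Vec.∷ v) _            Fin.zero    Fin.zero    _         = ℕP.≤-refl
  sorted⇒monotone (h Vec.∷ v) (h≤ ∷ _)     Fin.zero    (Fin.suc j) _         = VecAllP.lookup⁺ (VecAllP.toList⁻ h≤) j
  sorted⇒monotone (h Vec.∷ v) (_ ∷ sorted) (Fin.suc i) (Fin.suc j) (s≤s i≤j) = sorted⇒monotone v sorted i j i≤j

  IsOmega-nonneg : ∀ j hs xs → IsOmega m j hs xs → Fits j hs → All (+ 0 ℤ.≤_) xs
  IsOmega-nonneg j []       []       _          _          = []
  IsOmega-nonneg j (h ∷ hs) (x ∷ xs) (x≡ , ωhs) (h≤ , fits) =
    subst (+ 0 ℤ.≤_) (sym x≡) (ℤP.i≤j⇒0≤j-i (ℤ.+≤+ h≤)) ∷ IsOmega-nonneg (suc j) hs xs ωhs fits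

  step-difference : ∀ j h h′ → + (j ℕ.* m) - + h + + m - (+ (suc j ℕ.* m) - + h′) ≡ + h′ - + h
  step-difference j h h′ rewrite ℤP.pos-+ m (j ℕ.* m) = cancel (+ (j ℕ.* m)) (+ m) (+ h) (+ h′)
    where
    cancel : ∀ J M H H′ → J - H + M - (M + J - H′) ≡ H′ - H
    cancel = solve-∀

  IsOmega-linked : ∀ j hs xs → IsOmega m j hs xs → Linked _≤_ hs → Linked Step xs
  IsOmega-linked j []            []           _                 _           = []
  IsOmega-linked j (h ∷ [])      (x ∷ [])     _                 _           = [-]
  IsOmega-linked j (h ∷ h′ ∷ hs) (x ∷ y ∷ ys) (x≡ , y≡ , ωhs) (h≤h′ ∷ inc) =
    step ∷ IsOmega-linked (suc j) (h′ ∷ hs) (y ∷ ys) (y≡ , ωhs) inc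
    where
    step : Step x y
    step rewrite x≡ | y≡ = ≤-by-difference (sym (step-difference j h h′)) (ℤ.+≤+ h≤h′)

  board-admissible : ∀ {N} (b : Vec ℕ N) → IsBoard N m b → Admissible (omega b)
  board-admissible b (mono , fits) =
    startsAtZero b fits ,
    IsOmega-nonneg 0 (toList b) (omega b) (IsOmega-omega b) (fits⇒Fits 0 b fits) ,
    IsOmega-linked 0 (toList b) (omega b) (IsOmega-omega b) (AllPairs⇒Linked (monotone⇒sorted b mono))
    where
    startsAtZero : ∀ {N} (b : Vec ℕ N) → (∀ j → lookup b j ≤ toℕ j ℕ.* m) → StartsAtZero (omega b)
    startsAtZero Vec.[]      _    = tt
    startsAtZero (h Vec.∷ v) fits = cong (λ t → + 0 - + t) (ℕP.n≤0⇒n≡0 (fits Fin.zero))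

  omega-injective : ∀ {N} (b b′ : Vec ℕ N) → omega b ≡ omega b′ → b ≡ b′
  omega-injective b b′ eq = trans (sym (VecP.cast-is-id refl b)) (VecP.toList-injective refl b b′
    (IsOmega-heights-unique 0 (toList b) (toList b′) (omega b) (IsOmega-omega b)
                            (subst (IsOmega m 0 (toList b′)) (sym eq) (IsOmega-omega b′))))

  Bounded : ℕ → List ℤ → Set
  Bounded j []       = ⊤
  Bounded j (x ∷ xs) = x ℤ.≤ + (j ℕ.* m) × Bounded (suc j) xs

  linked-bounded : ∀ j x xs → x ℤ.≤ + (j ℕ.* m) → Linked Step (x ∷ xs) → Bounded j (x ∷ xs)
  linked-bounded j x []       x≤ _               = x≤ , tt
  linked-bounded j x (y ∷ ys) x≤ (y≤x+m ∷ steps) = x≤ , linked-bounded (suc j) y ys y≤ steps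
    where
    y≤ : y ℤ.≤ + (suc j ℕ.* m)
    y≤ = ℤP.≤-trans y≤x+m (subst (x + + m ℤ.≤_) (trans (ℤP.+-comm (+ (j ℕ.* m)) (+ m)) (sym (ℤP.pos-+ m (j ℕ.* m))))
                                 (ℤP.+-monoˡ-≤ (+ m) x≤))

  admissible-bounded : ∀ xs → Admissible xs → Bounded 0 xs
  admissible-bounded []       _                  = tt
  admissible-bounded (x ∷ xs) (refl , _ , steps) = linked-bounded 0 (+ 0) xs ℤP.≤-refl steps

  heights : ℕ → List ℤ → List ℕ
  heights j []       = []
  heights j (x ∷ xs) = ∣ + (j ℕ.* m) - x ∣ ∷ heights (suc j) xs

  length-heights : ∀ j xs → length (heights j xs) ≡ length xs
  length-heights j []       = refl
  length-heights j (x ∷ xs) = cong suc (length-heights (suc j) xs)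

  height-value : ∀ j x → x ℤ.≤ + (j ℕ.* m) → + ∣ + (j ℕ.* m) - x ∣ ≡ + (j ℕ.* m) - x
  height-value j x x≤ = ℤP.0≤i⇒+∣i∣≡i (ℤP.i≤j⇒0≤j-i x≤)

  IsOmega-heights : ∀ j xs → Bounded j xs → IsOmega m j (heights j xs) xs
  IsOmega-heights j []       _          = tt
  IsOmega-heights j (x ∷ xs) (x≤ , bnd) =
    trans (recover (+ (j ℕ.* m)) x) (cong (_-_ (+ (j ℕ.* m))) (sym (height-value j x x≤))) , IsOmega-heights (suc j) xs bnd
    where
    recover : ∀ J x → x ≡ J - (J - x)
    recover = solve-∀

  Fits-heights : ∀ j xs → All (+ 0 ℤ.≤_) xs → Bounded j xs → Fits j (heights j xs)
  Fits-heights j []       _              _          = tt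
  Fits-heights j (x ∷ xs) (0≤x ∷ nonneg) (x≤ , bnd) =
    ℤP.drop‿+≤+ (subst (ℤ._≤ + (j ℕ.* m)) (sym (height-value j x x≤)) (ℤP.i≤j⇒i-k≤j x {{ℤ.nonNegative 0≤x}} ℤP.≤-refl)) ,
    Fits-heights (suc j) xs nonneg bnd

  heights-linked : ∀ j xs → Linked Step xs → Bounded j xs → Linked _≤_ (heights j xs)
  heights-linked j []           _               _                  = []
  heights-linked j (x ∷ [])     _               _                  = [-]
  heights-linked j (x ∷ y ∷ ys) (y≤x+m ∷ steps) (x≤ , bnd@(y≤ , _)) = h≤h′ ∷ heights-linked (suc j) (y ∷ ys) steps bnd
    where
    growth : x + + m - y ≡ + (suc j ℕ.* m) - y - (+ (j ℕ.* m) - x)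
    growth rewrite ℤP.pos-+ m (j ℕ.* m) = regroup x y (+ m) (+ (j ℕ.* m))
      where
      regroup : ∀ x y M J → x + M - y ≡ M + J - y - (J - x)
      regroup = solve-∀
    h≤h′ : ∣ + (j ℕ.* m) - x ∣ ≤ ∣ + (suc j ℕ.* m) - y ∣
    h≤h′ = ℤP.drop‿+≤+ (subst₂ ℤ._≤_ (sym (height-value j x x≤)) (sym (height-value (suc j) y y≤))
                                    (≤-by-difference growth y≤x+m))

  board-of : ∀ N ys → Admissible ys → length ys ≡ N → Σ (Vec ℕ N) λ b → IsBoard N m b × omega b ≡ ys
  board-of N ys adm@(_ , nonneg , steps) len = b , (monotone , fits) , omega-b
    where
    hs : List ℕ
    hs = heights 0 ys
    bnd : Bounded 0 ys
    bnd = admissible-bounded ys adm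
    b : Vec ℕ N
    b = Vec.cast (trans (length-heights 0 ys) len) (Vec.fromList hs)
    toList-b : toList b ≡ hs
    toList-b = trans (VecP.toList-cast _ (Vec.fromList hs)) (VecP.toList∘fromList hs)
    monotone : ∀ i j → toℕ i ≤ toℕ j → lookup b i ≤ lookup b j
    monotone = sorted⇒monotone b (subst (AllPairs _≤_) (sym toList-b) (Linked⇒AllPairs ℕP.≤-trans (heights-linked 0 ys steps bnd)))
    fits : ∀ j → lookup b j ≤ toℕ j ℕ.* m
    fits = Fits⇒fits 0 b (subst (Fits 0) (sym toList-b) (Fits-heights 0 ys nonneg bnd))
    omega-b : omega b ≡ ys
    omega-b = IsOmega-unique 0 (toList b) (omega b) ys (IsOmega-omega b)
                             (subst (λ hs → IsOmega m 0 hs ys) (sym toList-b) (IsOmega-heights 0 ys bnd))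

module _ {A : Set} where

  move-to-front : ∀ pre (x y : A) post → pre ++ x ∷ y ∷ post ↭ y ∷ pre ++ x ∷ post
  move-to-front []        x y post = Perm.swap x y Perm.refl
  move-to-front (a ∷ pre) x y post = ↭-trans (Perm.prep a (move-to-front pre x y post)) (Perm.swap a y Perm.refl)

  ∈-mid : ∀ pre (x : A) post → x ∈ pre ++ x ∷ post
  ∈-mid []        x post = here refl
  ∈-mid (a ∷ pre) x post = there (∈-mid pre x post)

  All-remove : ∀ {P : A → Set} pre x y post → All P (pre ++ x ∷ y ∷ post) → All P (pre ++ x ∷ post)
  All-remove pre x y post ps with AllP.++⁻ pre ps
  ... | ps₁ , px ∷ _ ∷ ps₂ = AllP.++⁺ ps₁ (px ∷ ps₂)

  All-insert : ∀ {P : A → Set} pre x y post → All P (pre ++ x ∷ post) → P y → All P (pre ++ x ∷ y ∷ post)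
  All-insert pre x y post ps py with AllP.++⁻ pre ps
  ... | ps₁ , px ∷ ps₂ = AllP.++⁺ ps₁ (px ∷ py ∷ ps₂)

  module _ {R : A → A → Set} where

    RelHead : A → List A → Set
    RelHead x []      = ⊤
    RelHead x (y ∷ _) = R x y

    relHead-all : ∀ {x ys} → All (R x) ys → RelHead x ys
    relHead-all []      = tt
    relHead-all (r ∷ _) = r

    linked-cons : ∀ {x ys} → RelHead x ys → Linked R ys → Linked R (x ∷ ys)
    linked-cons {ys = []}    _ _  = [-]
    linked-cons {ys = _ ∷ _} r rs = r ∷ rs

    linked-tail : ∀ {x ys} → Linked R (x ∷ ys) → Linked R ys
    linked-tail [-]      = []
    linked-tail (_ ∷ rs) = rs

    linked-mid : ∀ pre x y post → Linked R (pre ++ x ∷ y ∷ post) → R x y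
    linked-mid []        x y post (r ∷ _) = r
    linked-mid (a ∷ pre) x y post rs      = linked-mid pre x y post (linked-tail rs)

    linked-remove : ∀ pre x y post → Linked R (pre ++ x ∷ y ∷ post) → RelHead x post → Linked R (pre ++ x ∷ post)
    linked-remove []             x y post (_ ∷ rs)   r = linked-cons r (linked-tail rs)
    linked-remove (a ∷ [])       x y post (rax ∷ rs) r = rax ∷ linked-remove [] x y post rs r
    linked-remove (a ∷ a′ ∷ pre) x y post (raa′ ∷ rs) r = raa′ ∷ linked-remove (a′ ∷ pre) x y post rs r

    linked-insert : ∀ pre x y post → Linked R (pre ++ x ∷ post) → R x y → RelHead y post → Linked R (pre ++ x ∷ y ∷ post)
    linked-insert []             x y post rs          rxy r = rxy ∷ linked-cons r (linked-tail rs)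
    linked-insert (a ∷ [])       x y post (rax ∷ rs)  rxy r = rax ∷ linked-insert [] x y post rs rxy r
    linked-insert (a ∷ a′ ∷ pre) x y post (raa′ ∷ rs) rxy r = raa′ ∷ linked-insert (a′ ∷ pre) x y post rs rxy r

StartsAtZero-mid : ∀ pre x C D → StartsAtZero (pre ++ x ∷ C) → StartsAtZero (pre ++ x ∷ D)
StartsAtZero-mid []      x C D s = s
StartsAtZero-mid (_ ∷ _) x C D s = s

sorted-head : ∀ {x xs} → Linked ℤ._≤_ (x ∷ xs) → All (x ℤ.≤_) (x ∷ xs)
sorted-head = Linked⇒All ℤP.≤-trans ℤP.≤-refl

sorted-last : ∀ pre z → Linked ℤ._≤_ (pre ++ z ∷ []) → All (ℤ._≤ z) (pre ++ z ∷ [])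
sorted-last []             z _            = ℤP.≤-refl ∷ []
sorted-last (a ∷ [])       z (a≤z ∷ _)    = a≤z ∷ ℤP.≤-refl ∷ []
sorted-last (a ∷ a′ ∷ pre) z (a≤a′ ∷ rest) with sorted-last (a′ ∷ pre) z rest
... | a′≤z ∷ rest≤z = ℤP.≤-trans a≤a′ a′≤z ∷ a′≤z ∷ rest≤z

sorted-unique : ∀ xs ys → Linked ℤ._≤_ xs → Linked ℤ._≤_ ys → xs ↭ ys → xs ≡ ys
sorted-unique []       []       _  _  _ = refl
sorted-unique []       (y ∷ ys) _  _  σ with PermP.↭-length σ
... | ()
sorted-unique (x ∷ xs) []       _  _  σ with PermP.↭-length σ
... | ()
sorted-unique (x ∷ xs) (y ∷ ys) sx sy σ with ℤP.≤-antisym (minimal sx (↭-sym σ)) (minimal sy σ)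
  where
  minimal : ∀ {u us v vs} → Linked ℤ._≤_ (u ∷ us) → v ∷ vs ↭ u ∷ us → u ℤ.≤ v
  minimal su τ = All.lookup (sorted-head su) (PermP.∈-resp-↭ τ (here refl))
... | refl = cong (x ∷_) (sorted-unique xs ys (linked-tail sx) (linked-tail sy) (PermP.drop-∷ σ))

module _ (m : ℕ) where

  asc : List ℤ → ℕ
  asc = pairSum (λ a b → stepDown m b a)

  desc : List ℤ → ℕ
  desc = pairSum (stepDown m)

  positive : ℤ → ℕ
  positive a = bit ⌊ + 0 ℤ.<? a ⌋

  positives : List ℤ → ℕ
  positives xs = sum (map positive xs)

  stepDown-interval : ∀ a b → stepDown m a b ≡ between (ℤ.suc b) (b + + m) a
  stepDown-interval a b =
    trans (between-shift b (+ 1) (+ m) (a - b)) (between-cong refl (ℤP.+-comm (+ m) b) (cancel a b))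
    where
    cancel : ∀ a b → a - b + b ≡ a
    cancel = solve-∀

  stepDown-≤ : ∀ a b → a ℤ.≤ b → stepDown m a b ≡ 0
  stepDown-≤ a b a≤b = trans (stepDown-interval a b)
    (between-no _ _ a (λ (b<a , _) → ℤP.<-irrefl refl (ℤP.<-≤-trans (ℤP.suc[i]≤j⇒i<j b<a) a≤b)))

  stepDown-near : ∀ M x → x ℤ.< M → M ℤ.≤ x + + m → stepDown m M x ≡ 1
  stepDown-near M x x<M M≤ = trans (stepDown-interval M x) (between-yes _ _ M (ℤP.i<j⇒suc[i]≤j x<M) M≤)

  stepDown-far : ∀ M x → ¬ (M ℤ.≤ x + + m) → stepDown m M x ≡ 0
  stepDown-far M x far = trans (stepDown-interval M x) (between-no _ _ M (far ∘ proj₂))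

  stepDown-zero⇒far : ∀ M x → stepDown m M x ≡ 0 → x ℤ.< M → ¬ (M ℤ.≤ x + + m)
  stepDown-zero⇒far M x isZero x<M near with trans (sym isZero) (stepDown-near M x x<M near)
  ... | ()

  ++-snoc : ∀ pre (x : ℤ) post → (pre ++ x ∷ []) ++ post ≡ pre ++ x ∷ post
  ++-snoc pre x post = LP.++-assoc pre (x ∷ []) post

  asc-insert : ∀ pre x M post → x ℤ.< M → M ℤ.≤ x + + m → All (ℤ._≤ M) post →
               asc (pre ++ x ∷ M ∷ post) ≡ asc (pre ++ x ∷ post) ℕ.+ (sum (map (stepDown m M) pre) ℕ.+ 1)
  asc-insert pre x M post x<M M≤ post≤M = begin
      asc (pre ++ x ∷ M ∷ post)
    ≡⟨ cong asc (sym (++-snoc pre x (M ∷ post))) ⟩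
      asc ((pre ++ x ∷ []) ++ M ∷ post)
    ≡⟨ pairSum-insert (λ a b → stepDown m b a) (pre ++ x ∷ []) M post ⟩
      asc ((pre ++ x ∷ []) ++ post) ℕ.+ sum (map (stepDown m M) (pre ++ x ∷ [])) ℕ.+ sum (map (λ b → stepDown m b M) post)
    ≡⟨ cong₂ (λ u v → asc u ℕ.+ v ℕ.+ sum (map (λ b → stepDown m b M) post)) (++-snoc pre x post) earlier ⟩
      asc (pre ++ x ∷ post) ℕ.+ (sum (map (stepDown m M) pre) ℕ.+ 1) ℕ.+ sum (map (λ b → stepDown m b M) post)
    ≡⟨ cong (asc (pre ++ x ∷ post) ℕ.+ (sum (map (stepDown m M) pre) ℕ.+ 1) ℕ.+_)
            (sum-map-zero _ post (All.map (λ {b} b≤M → stepDown-≤ b M b≤M) post≤M)) ⟩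
      asc (pre ++ x ∷ post) ℕ.+ (sum (map (stepDown m M) pre) ℕ.+ 1) ℕ.+ 0
    ≡⟨ ℕP.+-identityʳ _ ⟩
      asc (pre ++ x ∷ post) ℕ.+ (sum (map (stepDown m M) pre) ℕ.+ 1)
    ∎
    where
    open ≡-Reasoning
    earlier : sum (map (stepDown m M) (pre ++ x ∷ [])) ≡ sum (map (stepDown m M) pre) ℕ.+ 1
    earlier = begin
      sum (map (stepDown m M) (pre ++ x ∷ []))               ≡⟨ cong sum (LP.map-++ (stepDown m M) pre (x ∷ [])) ⟩
      sum (map (stepDown m M) pre ++ stepDown m M x ∷ [])    ≡⟨ sum-++ (map (stepDown m M) pre) (stepDown m M x ∷ []) ⟩
      sum (map (stepDown m M) pre) ℕ.+ (stepDown m M x ℕ.+ 0) ≡⟨ cong (λ t → sum (map (stepDown m M) pre) ℕ.+ (t ℕ.+ 0)) (stepDown-near M x x<M M≤) ⟩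
      sum (map (stepDown m M) pre) ℕ.+ 1                     ∎

  desc-insert : ∀ pre x M post → All (ℤ._≤ M) pre → x ℤ.≤ M →
                desc (pre ++ x ∷ M ∷ post) ≡ desc (pre ++ x ∷ post) ℕ.+ sum (map (stepDown m M) post)
  desc-insert pre x M post pre≤M x≤M = begin
      desc (pre ++ x ∷ M ∷ post)
    ≡⟨ cong desc (sym (++-snoc pre x (M ∷ post))) ⟩
      desc ((pre ++ x ∷ []) ++ M ∷ post)
    ≡⟨ pairSum-insert (stepDown m) (pre ++ x ∷ []) M post ⟩
      desc ((pre ++ x ∷ []) ++ post) ℕ.+ sum (map (λ a → stepDown m a M) (pre ++ x ∷ [])) ℕ.+ sum (map (stepDown m M) post)
    ≡⟨ cong₂ (λ u v → desc u ℕ.+ v ℕ.+ sum (map (stepDown m M) post)) (++-snoc pre x post)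
             (sum-map-zero _ (pre ++ x ∷ []) (All.map (λ {a} a≤M → stepDown-≤ a M a≤M) (AllP.++⁺ pre≤M (x≤M ∷ [])))) ⟩
      desc (pre ++ x ∷ post) ℕ.+ 0 ℕ.+ sum (map (stepDown m M) post)
    ≡⟨ cong (ℕ._+ sum (map (stepDown m M) post)) (ℕP.+-identityʳ _) ⟩
      desc (pre ++ x ∷ post) ℕ.+ sum (map (stepDown m M) post)
    ∎
    where open ≡-Reasoning

  positives-insert : ∀ pre x M post → + 0 ℤ.< M → positives (pre ++ x ∷ M ∷ post) ≡ suc (positives (pre ++ x ∷ post))
  positives-insert pre x M post M>0 =
    trans (sum-↭ (PermP.map⁺ positive (move-to-front pre x M post)))
          (cong (ℕ._+ positives (pre ++ x ∷ post)) (bit-yes M>0 (+ 0 ℤ.<? M)))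

  AllZero : List ℤ → Set
  AllZero = All (_≡ + 0)

  record Peel (xs : List ℤ) : Set where
    constructor peel
    field
      before    : List ℤ
      x M       : ℤ
      after     : List ℤ
      split     : xs ≡ before ++ x ∷ M ∷ after
      before<M  : All (ℤ._< M) before
      x<M       : x ℤ.< M
      M≤x+m     : M ℤ.≤ x + + m
      after≤M   : All (ℤ._≤ M) after
      M-positive : + 0 ℤ.< M

    rest : List ℤ
    rest = before ++ x ∷ after

  record FirstMax (xs : List ℤ) : Set where
    constructor firstMax
    field
      pre   : List ℤ
      M     : ℤ
      post  : List ℤ
      split : xs ≡ pre ++ M ∷ post
      pre<M : All (ℤ._< M) pre
      post≤M : All (ℤ._≤ M) post

  firstMax-≤ : ∀ {xs} (f : FirstMax xs) → All (ℤ._≤ FirstMax.M f) xs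
  firstMax-≤ (firstMax pre M post refl pre<M post≤M) = AllP.++⁺ (All.map ℤP.<⇒≤ pre<M) (ℤP.≤-refl ∷ post≤M)

  findFirstMax : ∀ x xs → FirstMax (x ∷ xs)
  findFirstMax x []       = firstMax [] x [] refl [] []
  findFirstMax x (y ∷ ys) with findFirstMax y ys
  ... | f@(firstMax pre M post split pre<M post≤M) with x ℤ.<? M
  ...   | yes x<M = firstMax (x ∷ pre) M post (cong (x ∷_) split) (x<M ∷ pre<M) post≤M
  ...   | no x≮M  = firstMax [] x (y ∷ ys) refl [] (All.map (λ a≤M → ℤP.≤-trans a≤M (ℤP.≮⇒≥ x≮M)) (firstMax-≤ f))

  peel-at : ∀ {xs} pre M post → xs ≡ pre ++ M ∷ post → All (ℤ._< M) pre → All (ℤ._≤ M) post →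
            + 0 ℤ.< M → Admissible m xs → Peel xs
  peel-at pre M post split pre<M post≤M M>0 adm with initLast pre
  peel-at .[] M post refl [] post≤M M>0 (refl , _) | [] = ⊥-elim (ℤP.<-irrefl refl M>0)
  peel-at {xs} .(before ∷ʳ x) M post split pre<M post≤M M>0 (_ , _ , steps) | before ∷ʳ′ x =
    peel before x M post split′ (proj₁ pre<M′) (All.head (proj₂ pre<M′))
         (linked-mid before x M post (subst (Linked (Step m)) split′ steps)) post≤M M>0
    where
    split′ : xs ≡ before ++ x ∷ M ∷ post
    split′ = trans split (LP.++-assoc before (x ∷ []) (M ∷ post))
    pre<M′ : All (ℤ._< M) before × All (ℤ._< M) (x ∷ [])
    pre<M′ = AllP.++⁻ before pre<M

  classify : ∀ xs → Admissible m xs → AllZero xs ⊎ Peel xs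
  classify []       _ = inj₁ []
  classify (a ∷ as) adm@(_ , nonneg , _) with findFirstMax a as
  ... | f@(firstMax pre M post split pre<M post≤M) with + 0 ℤ.<? M
  ...   | no M≯0  = inj₁ (All.zipWith (λ (0≤y , y≤M) → ℤP.≤-antisym (ℤP.≤-trans y≤M (ℤP.≮⇒≥ M≯0)) 0≤y) (nonneg , firstMax-≤ f))
  ...   | yes M>0 = inj₂ (peel-at pre M post split pre<M post≤M M>0 adm)

  module _ {xs : List ℤ} (r : Peel xs) where
    open Peel r

    length-peel : length xs ≡ suc (length rest)
    length-peel = trans (cong length split) (PermP.↭-length (move-to-front before x M after))

    peel-↭ : xs ↭ M ∷ rest
    peel-↭ = subst (_↭ M ∷ rest) (sym split) (move-to-front before x M after)

    M-∈ : M ∈ xs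
    M-∈ = PermP.∈-resp-↭ (↭-sym peel-↭) (here refl)

    ≤M : All (ℤ._≤ M) xs
    ≤M = subst (All (ℤ._≤ M)) (sym split) (AllP.++⁺ (All.map ℤP.<⇒≤ before<M) (ℤP.<⇒≤ x<M ∷ ℤP.≤-refl ∷ after≤M))

    rest-≤M : All (ℤ._≤ M) rest
    rest-≤M = AllP.++⁺ (All.map ℤP.<⇒≤ before<M) (ℤP.<⇒≤ x<M ∷ after≤M)

    rest-admissible : Admissible m xs → Admissible m rest
    rest-admissible (start , nonneg , steps) rewrite split =
      StartsAtZero-mid before x (M ∷ after) after start ,
      All-remove before x M after nonneg ,
      linked-remove before x M after steps (relHead-all (All.map (λ y≤M → ℤP.≤-trans y≤M M≤x+m) after≤M))

    asc-peel : asc xs ≡ asc rest ℕ.+ (sum (map (stepDown m M) before) ℕ.+ 1)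
    asc-peel rewrite split = asc-insert before x M after x<M M≤x+m after≤M

    desc-peel : desc xs ≡ desc rest ℕ.+ sum (map (stepDown m M) after)
    desc-peel rewrite split = desc-insert before x M after (All.map ℤP.<⇒≤ before<M) (ℤP.<⇒≤ x<M)

    positives-peel : positives xs ≡ suc (positives rest)
    positives-peel rewrite split = positives-insert before x M after M-positive

    x-∈-rest : x ∈ rest
    x-∈-rest = ∈-mid before x after

  peel-induction : (P : List ℤ → Set) → (∀ {xs} → Admissible m xs → AllZero xs → P xs) →
                   (∀ {xs} → Admissible m xs → (r : Peel xs) → P (Peel.rest r) → P xs) →
                   ∀ xs → Admissible m xs → P xs
  peel-induction P base step xs = go (length xs) xs refl
    where
    go : ∀ n xs → length xs ≡ n → Admissible m xs → P xs
    go n xs len adm with classify xs adm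
    ... | inj₁ zeros = base adm zeros
    go zero    xs len adm | inj₂ r = ⊥-elim (ℕP.1+n≢0 (trans (sym (length-peel r)) len))
    go (suc n) xs len adm | inj₂ r =
      step adm r (go n (Peel.rest r) (ℕP.suc-injective (trans (sym (length-peel r)) len)) (rest-admissible r adm))

  zeros-asc : ∀ {xs} → AllZero xs → asc xs ≡ 0
  zeros-asc []          = refl
  zeros-asc (refl ∷ zs) = cong₂ ℕ._+_ (sum-map-zero _ _ (All.map (λ { refl → stepDown-≤ (+ 0) (+ 0) ℤP.≤-refl }) zs)) (zeros-asc zs)

  zeros-positives : ∀ {xs} → AllZero xs → positives xs ≡ 0
  zeros-positives zs = sum-map-zero positive _ (All.map (λ { refl → refl }) zs)

  zeros-sorted : ∀ {xs} → AllZero xs → Linked ℤ._≤_ xs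
  zeros-sorted []                 = []
  zeros-sorted (refl ∷ [])        = [-]
  zeros-sorted (refl ∷ refl ∷ zs) = ℤP.≤-refl ∷ zeros-sorted (refl ∷ zs)

  sorted⇒desc-zero : ∀ {xs} → Linked ℤ._≤_ xs → desc xs ≡ 0
  sorted⇒desc-zero sorted = go (Linked⇒AllPairs ℤP.≤-trans sorted)
    where
    go : ∀ {xs} → AllPairs ℤ._≤_ xs → desc xs ≡ 0
    go []               = refl
    go {a ∷ as} (a≤ ∷ ps) = cong₂ ℕ._+_ (sum-map-zero _ as (All.map (λ {b} a≤b → stepDown-≤ a b a≤b) a≤)) (go ps)

  -- (3a) Every admissible arrangement has at least as many m-ascents as
  -- positive entries: the first maximum M > 0 forms an ascent with x.
  positives≤asc : ∀ xs → Admissible m xs → positives xs ≤ asc xs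
  positives≤asc = peel-induction (λ xs → positives xs ≤ asc xs)
    (λ {xs} _ zs → subst (_≤ asc xs) (sym (zeros-positives zs)) z≤n)
    (λ {xs} _ r ih → begin
      positives xs                                                     ≡⟨ positives-peel r ⟩
      suc (positives (Peel.rest r))                                    ≤⟨ s≤s ih ⟩
      suc (asc (Peel.rest r))                                          ≡⟨ ℕP.+-comm 1 _ ⟩
      asc (Peel.rest r) ℕ.+ 1                                          ≤⟨ ℕP.+-monoʳ-≤ (asc (Peel.rest r)) (ℕP.m≤n+m 1 _) ⟩
      asc (Peel.rest r) ℕ.+ (sum (map (stepDown m (Peel.M r)) (Peel.before r)) ℕ.+ 1) ≡⟨ asc-peel r ⟨
      asc xs                                                           ∎)
    where open ℕP.≤-Reasoning

  desc-zero⇒sorted : ∀ xs → Admissible m xs → desc xs ≡ 0 → Linked ℤ._≤_ xs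
  desc-zero⇒sorted = peel-induction (λ xs → desc xs ≡ 0 → Linked ℤ._≤_ xs) (λ _ zs _ → zeros-sorted zs) step
    where
    step : ∀ {xs} → Admissible m xs → (r : Peel xs) → (desc (Peel.rest r) ≡ 0 → Linked ℤ._≤_ (Peel.rest r)) →
           desc xs ≡ 0 → Linked ℤ._≤_ xs
    step _ r@(peel before x M after refl _ x<M M≤ after≤M _) ih d≡0 =
      linked-insert before x M after sorted (ℤP.<⇒≤ x<M) (M≤head after sorted noDescents)
      where
      d≡0′ : desc (Peel.rest r) ℕ.+ sum (map (stepDown m M) after) ≡ 0
      d≡0′ = trans (sym (desc-peel r)) d≡0
      sorted : Linked ℤ._≤_ (before ++ x ∷ after)
      sorted = ih (ℕP.m+n≡0⇒m≡0 _ d≡0′)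
      noDescents : All (λ y → stepDown m M y ≡ 0) after
      noDescents = sum-map-zero⁻ _ after (ℕP.m+n≡0⇒n≡0 (desc (Peel.rest r)) d≡0′)
      -- The entry y after M satisfies y ≥ x, so y < M would make (M, y) a descent.
      M≤head : ∀ ys → Linked ℤ._≤_ (before ++ x ∷ ys) → All (λ y → stepDown m M y ≡ 0) ys → RelHead {R = ℤ._≤_} M ys
      M≤head []       _       _          = tt
      M≤head (y ∷ ys) sorted′ (y-ok ∷ _) with y ℤ.<? M
      ... | no y≮M  = ℤP.≮⇒≥ y≮M
      ... | yes y<M = ⊥-elim (stepDown-zero⇒far M y y-ok y<M
                               (ℤP.≤-trans M≤ (ℤP.+-monoˡ-≤ (+ m) (linked-mid before x y ys sorted′))))

  -- (3c) Every admissible multiset has a weakly increasing admissible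
  -- arrangement: append the peeled maximum to a sorted arrangement of the rest.
  sorted-arrangement : ∀ xs → Admissible m xs → Σ (List ℤ) λ ys → Admissible m ys × ys ↭ xs × Linked ℤ._≤_ ys
  sorted-arrangement = peel-induction _ (λ {xs} adm zs → xs , adm , Perm.refl , zeros-sorted zs)
                                      (λ _ r (ys′ , adm′ , σ′ , sorted′) → append-max r ys′ adm′ σ′ sorted′)
    where
    append-max : ∀ {xs} (r : Peel xs) ys′ → Admissible m ys′ → ys′ ↭ Peel.rest r → Linked ℤ._≤_ ys′ →
                 Σ (List ℤ) λ ys → Admissible m ys × ys ↭ xs × Linked ℤ._≤_ ys
    append-max r ys′ adm′ σ′ sorted′ with initLast ys′
    append-max r .[] _ σ′ _ | [] with PermP.∈-resp-↭ (↭-sym σ′) (x-∈-rest r)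
    ... | ()
    append-max r .(A ∷ʳ z) (start , nonneg , steps) σ′ sorted′ | A ∷ʳ′ z =
      A ++ z ∷ M ∷ [] ,
      (StartsAtZero-mid A z [] (M ∷ []) start , All-insert A z M [] nonneg (ℤP.<⇒≤ (Peel.M-positive r)) ,
       linked-insert A z M [] steps z-step tt) ,
      ↭-trans (move-to-front A z M []) (↭-trans (Perm.prep M σ′) (↭-sym (peel-↭ r))) ,
      linked-insert A z M [] sorted′ z≤M tt
      where
      M : ℤ
      M = Peel.M r
      x≤z : Peel.x r ℤ.≤ z
      x≤z = All.lookup (sorted-last A z sorted′) (PermP.∈-resp-↭ (↭-sym σ′) (x-∈-rest r))
      z-step : Step m z M
      z-step = ℤP.≤-trans (Peel.M≤x+m r) (ℤP.+-monoˡ-≤ (+ m) x≤z)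
      z≤M : z ℤ.≤ M
      z≤M = All.lookup (rest-≤M r) (PermP.∈-resp-↭ σ′ (∈-mid A z []))

  record Slot (M : ℤ) (ys : List ℤ) : Set where
    constructor slot
    field
      pre   : List ℤ
      z     : ℤ
      post  : List ℤ
      split : ys ≡ pre ++ z ∷ post
      far   : All (λ a → ¬ (M ℤ.≤ a + + m)) pre
      near  : M ℤ.≤ z + + m
      z<M   : z ℤ.< M

  -- In an admissible sequence such a z lies below M: either it is the
  -- leading 0, or its predecessor p has z ≤ p + m < M.
  find-slot-after : ∀ M p ws → ¬ (M ℤ.≤ p + + m) → Linked (Step m) (p ∷ ws) → Any (λ w → M ℤ.≤ w + + m) ws → Slot M ws
  find-slot-after M p (w ∷ ws) p-far (w≤p+m ∷ steps) any with M ℤ.≤? w + + m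
  ... | yes near = slot [] w ws refl [] near (ℤP.≤-<-trans w≤p+m (ℤP.≰⇒> p-far))
  ... | no w-far with any
  ...   | here near = ⊥-elim (w-far near)
  ...   | there any′ with find-slot-after M w ws w-far steps any′
  ...     | slot pre z post split far near z<M = slot (w ∷ pre) z post (cong (w ∷_) split) (w-far ∷ far) near z<M

  find-slot : ∀ M ys → Admissible m ys → Any (λ w → M ℤ.≤ w + + m) ys → + 0 ℤ.< M → Slot M ys
  find-slot M (y ∷ ws) (refl , _ , steps) any M>0 with M ℤ.≤? y + + m
  ... | yes near = slot [] y ws refl [] near M>0
  ... | no y-far with any
  ...   | here near = ⊥-elim (y-far near)
  ...   | there any′ with find-slot-after M y ws y-far steps any′
  ...     | slot pre z post split far near z<M = slot (y ∷ pre) z post (cong (y ∷_) split) (y-far ∷ far) near z<M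

  -- (3d) Some admissible arrangement has exactly as many m-ascents as
  -- positive entries: insert the peeled maximum at its slot.
  tight-arrangement : ∀ xs → Admissible m xs → Σ (List ℤ) λ ys → Admissible m ys × ys ↭ xs × asc ys ≤ positives ys
  tight-arrangement = peel-induction _
    (λ {xs} adm zs → xs , adm , Perm.refl , subst (_≤ positives xs) (sym (zeros-asc zs)) z≤n)
    (λ _ r (ys′ , adm′ , σ′ , tight′) → insert-max r ys′ adm′ σ′ tight′
       (find-slot (Peel.M r) ys′ adm′ (PermP.Any-resp-↭ (↭-sym σ′) (Any.map (λ { refl → Peel.M≤x+m r }) (x-∈-rest r)))
                  (Peel.M-positive r)))
    where
    insert-max : ∀ {xs} (r : Peel xs) ys′ → Admissible m ys′ → ys′ ↭ Peel.rest r → asc ys′ ≤ positives ys′ →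
                 Slot (Peel.M r) ys′ → Σ (List ℤ) λ ys → Admissible m ys × ys ↭ xs × asc ys ≤ positives ys
    insert-max r .(A ++ z ∷ B) (starts , nonneg , steps) σ′ tight′ (slot A z B refl far near z<M) =
      A ++ z ∷ M ∷ B ,
      (StartsAtZero-mid A z B (M ∷ B) starts , All-insert A z M B nonneg (ℤP.<⇒≤ M>0) ,
       linked-insert A z M B steps near (relHead-all (All.map (λ y≤M → ℤP.≤-trans y≤M (ℤP.i≤i+j M (+ m))) B≤M))) ,
      ↭-trans (move-to-front A z M B) (↭-trans (Perm.prep M σ′) (↭-sym (peel-↭ r))) ,
      tight
      where
      M : ℤ
      M = Peel.M r
      M>0 : + 0 ℤ.< M
      M>0 = Peel.M-positive r
      B≤M : All (ℤ._≤ M) B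
      B≤M = All.tail (proj₂ (AllP.++⁻ A (PermP.All-resp-↭ (↭-sym σ′) (rest-≤M r))))
      tight : asc (A ++ z ∷ M ∷ B) ≤ positives (A ++ z ∷ M ∷ B)
      tight = let open ℕP.≤-Reasoning in begin
        asc (A ++ z ∷ M ∷ B)                                       ≡⟨ asc-insert A z M B z<M near B≤M ⟩
        asc (A ++ z ∷ B) ℕ.+ (sum (map (stepDown m M) A) ℕ.+ 1)    ≡⟨ cong (λ s → asc (A ++ z ∷ B) ℕ.+ (s ℕ.+ 1))
                                                                        (sum-map-zero _ A (All.map (λ {a} → stepDown-far M a) far)) ⟩
        asc (A ++ z ∷ B) ℕ.+ 1                                     ≤⟨ ℕP.+-monoˡ-≤ 1 tight′ ⟩
        positives (A ++ z ∷ B) ℕ.+ 1                               ≡⟨ ℕP.+-comm _ 1 ⟩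
        suc (positives (A ++ z ∷ B))                               ≡⟨ positives-insert A z M B M>0 ⟨
        positives (A ++ z ∷ M ∷ B)                                 ∎

  insert-at-slot : ℤ → List ℤ → List ℤ
  insert-at-slot M []       = M ∷ []
  insert-at-slot M (z ∷ zs) with M ℤ.≤? z + + m
  ... | yes _ = z ∷ M ∷ zs
  ... | no _  = z ∷ insert-at-slot M zs

  insert-at-slot-≡ : ∀ M pre x post → All (λ a → ¬ (M ℤ.≤ a + + m)) pre → M ℤ.≤ x + + m →
                     insert-at-slot M (pre ++ x ∷ post) ≡ pre ++ x ∷ M ∷ post
  insert-at-slot-≡ M []        x post _          near with M ℤ.≤? x + + m
  ... | yes _  = refl
  ... | no far = ⊥-elim (far near)
  insert-at-slot-≡ M (a ∷ pre) x post (a-far ∷ far) near with M ℤ.≤? a + + m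
  ... | yes a-near = ⊥-elim (a-far a-near)
  ... | no _       = cong (a ∷_) (insert-at-slot-≡ M pre x post far near)

  -- If asc xs ≤ positives xs, then the peeled maximum sat at its slot and
  -- the rest satisfies the same bound (by (3a) applied to the rest).
  tight-peel : ∀ {xs} → Admissible m xs → (r : Peel xs) → asc xs ≤ positives xs →
               xs ≡ insert-at-slot (Peel.M r) (Peel.rest r) × asc (Peel.rest r) ≤ positives (Peel.rest r)
  tight-peel adm r@(peel before x M after split before<M x<M M≤ _ _) tight =
    trans split (sym (insert-at-slot-≡ M before x after before-far M≤)) , ℕP.≤-trans (ℕP.m≤m+n a S) a+S≤p
    where
    a p S : ℕ
    a = asc (Peel.rest r)
    p = positives (Peel.rest r)
    S = sum (map (stepDown m M) before)
    a+S≤p : a ℕ.+ S ≤ p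
    a+S≤p = ℕP.+-cancelʳ-≤ 1 _ _ (subst₂ _≤_ (trans (asc-peel r) (sym (ℕP.+-assoc a S 1)))
                                              (trans (positives-peel r) (ℕP.+-comm 1 p)) tight)
    S≡0 : S ≡ 0
    S≡0 = ℕP.n≤0⇒n≡0 (ℕP.+-cancelˡ-≤ a S 0 (subst (a ℕ.+ S ≤_) (sym (ℕP.+-identityʳ a))
            (ℕP.≤-trans a+S≤p (positives≤asc (Peel.rest r) (rest-admissible r adm)))))
    before-far : All (λ a → ¬ (M ℤ.≤ a + + m)) before
    before-far = All.zipWith (λ (isZero , a<M) → stepDown-zero⇒far M _ isZero a<M) (sum-map-zero⁻ _ before S≡0 , before<M)

  zeros-unique : ∀ {xs ys} → AllZero xs → AllZero ys → length xs ≡ length ys → xs ≡ ys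
  zeros-unique {[]}    {[]}    []          []          _   = refl
  zeros-unique {_ ∷ _} {_ ∷ _} (refl ∷ zs) (refl ∷ zs′) len = cong (+ 0 ∷_) (zeros-unique zs zs′ (ℕP.suc-injective len))

  tight-unique : ∀ xs → Admissible m xs → ∀ ys → Admissible m ys → xs ↭ ys →
                 asc xs ≤ positives xs → asc ys ≤ positives ys → xs ≡ ys
  tight-unique = peel-induction _
    (λ _ zs ys _ σ _ _ → zeros-unique zs (PermP.All-resp-↭ σ zs) (PermP.↭-length σ))
    step
    where
    step : ∀ {xs} → Admissible m xs → (r : Peel xs) →
           (∀ ys → Admissible m ys → Peel.rest r ↭ ys → asc (Peel.rest r) ≤ positives (Peel.rest r) → asc ys ≤ positives ys → Peel.rest r ≡ ys) →
           ∀ ys → Admissible m ys → xs ↭ ys → asc xs ≤ positives xs → asc ys ≤ positives ys → xs ≡ ys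
    step adm rx ih ys adm-y σ tight-x tight-y with classify ys adm-y
    ... | inj₁ zs = ⊥-elim (ℤP.<-irrefl (sym (All.lookup zs (PermP.∈-resp-↭ σ (M-∈ rx)))) (Peel.M-positive rx))
    ... | inj₂ ry = begin
        _                                           ≡⟨ proj₁ (tight-peel adm rx tight-x) ⟩
        insert-at-slot (Peel.M rx) (Peel.rest rx)   ≡⟨ cong₂ insert-at-slot M≡ rest≡ ⟩
        insert-at-slot (Peel.M ry) (Peel.rest ry)   ≡⟨ proj₁ (tight-peel adm-y ry tight-y) ⟨
        ys                                          ∎
      where
      open ≡-Reasoning
      M≡ : Peel.M rx ≡ Peel.M ry
      M≡ = ℤP.≤-antisym (All.lookup (≤M ry) (PermP.∈-resp-↭ σ (M-∈ rx))) (All.lookup (≤M rx) (PermP.∈-resp-↭ (↭-sym σ) (M-∈ ry)))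
      rest↭ : Peel.rest rx ↭ Peel.rest ry
      rest↭ = PermP.drop-∷ (↭-trans (↭-sym (peel-↭ rx)) (↭-trans σ (subst (λ M → ys ↭ M ∷ Peel.rest ry) (sym M≡) (peel-↭ ry))))
      rest≡ : Peel.rest rx ≡ Peel.rest ry
      rest≡ = ih (Peel.rest ry) (rest-admissible ry adm-y) rest↭ (proj₂ (tight-peel adm rx tight-x)) (proj₂ (tight-peel adm-y ry tight-y))

trade : ∀ {a b c d} → a ℕ.+ b ≡ c ℕ.+ d → d ≤ b → a ≤ c
trade {a} {b} {c} {d} a+b≡c+d d≤b = ℕP.+-cancelʳ-≤ b a c (subst (_≤ c ℕ.+ b) (sym a+b≡c+d) (ℕP.+-monoʳ-≤ c d≤b))

trade⁻ : ∀ {a b c d} → a ℕ.+ b ≡ c ℕ.+ d → a ≤ c → d ≤ b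
trade⁻ {a} {b} {c} {d} a+b≡c+d a≤c = ℕP.+-cancelˡ-≤ c d b (subst (_≤ c ℕ.+ b) a+b≡c+d (ℕP.+-monoˡ-≤ b a≤c))

module _ (m : ℕ) where

  fileNum-omega : ∀ {N} (B : Vec ℕ N) → IsBoard N m B → ∀ k → fileNum k m B ≡ fileSeq m (reverse (omega m B)) k
  fileNum-omega B (mono , _) k = fileNum-fileSeq k m B (omega m B) (monotone⇒sorted m B mono) (IsOmega-omega m B)

  fileEquiv⇒↭ : ∀ {N} (B B₀ : Vec ℕ N) → IsBoard N m B → IsBoard N m B₀ → FileEquiv m B B₀ → omega m B ↭ omega m B₀
  fileEquiv⇒↭ B B₀ isB isB₀ equiv =
    ↭-trans (↭-sym (PermP.↭-reverse (omega m B)))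
      (↭-trans (fileSeq-injective m _ _ same-length (λ k → trans (sym (fileNum-omega B isB k)) (trans (equiv k) (fileNum-omega B₀ isB₀ k))))
               (PermP.↭-reverse (omega m B₀)))
    where
    same-length : length (reverse (omega m B)) ≡ length (reverse (omega m B₀))
    same-length = trans (LP.length-reverse (omega m B))
                        (trans (length-omega m B) (sym (trans (LP.length-reverse (omega m B₀)) (length-omega m B₀))))

  ↭⇒fileEquiv : ∀ {N} (B B₀ : Vec ℕ N) → IsBoard N m B → IsBoard N m B₀ → omega m B ↭ omega m B₀ → FileEquiv m B B₀
  ↭⇒fileEquiv B B₀ isB isB₀ σ k =
    trans (fileNum-omega B isB k) (trans (fileSeq-↭ m reverse-σ k) (sym (fileNum-omega B₀ isB₀ k)))
    where
    reverse-σ : reverse (omega m B) ↭ reverse (omega m B₀)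
    reverse-σ = ↭-trans (PermP.↭-reverse (omega m B)) (↭-trans σ (↭-sym (PermP.↭-reverse (omega m B₀))))

  dinvSeq+asc-↭ : ∀ {xs ys} → xs ↭ ys → dinvSeq m xs ℕ.+ asc m xs ≡ dinvSeq m ys ℕ.+ asc m ys
  dinvSeq+asc-↭ {xs} {ys} σ = begin
    dinvSeq m xs ℕ.+ asc m xs                                         ≡⟨ cong (ℕ._+ asc m xs) (dinvSeq-pairSum m xs) ⟩
    pairSum (dinvWeight m) xs ℕ.+ asc m xs                            ≡⟨ pairSum-+ (dinvWeight m) _ xs ⟨
    pairSum (λ a b → dinvWeight m a b ℕ.+ stepDown m b a) xs          ≡⟨ pairSum-↭ _ (exchange m) σ ⟩
    pairSum (λ a b → dinvWeight m a b ℕ.+ stepDown m b a) ys          ≡⟨ pairSum-+ (dinvWeight m) _ ys ⟩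
    pairSum (dinvWeight m) ys ℕ.+ asc m ys                            ≡⟨ cong (ℕ._+ asc m ys) (dinvSeq-pairSum m ys) ⟨
    dinvSeq m ys ℕ.+ asc m ys                                         ∎
    where open ≡-Reasoning

  asc+desc-↭ : ∀ {xs ys} → xs ↭ ys → asc m xs ℕ.+ desc m xs ≡ asc m ys ℕ.+ desc m ys
  asc+desc-↭ {xs} {ys} σ =
    trans (sym (pairSum-+ (λ a b → stepDown m b a) (stepDown m) xs))
          (trans (pairSum-↭ _ (λ a b → ℕP.+-comm (stepDown m b a) (stepDown m a b)) σ)
                 (pairSum-+ (λ a b → stepDown m b a) (stepDown m) ys))

  positives-↭ : ∀ {xs ys} → xs ↭ ys → positives m xs ≡ positives m ys
  positives-↭ σ = sum-↭ (PermP.map⁺ (positive m) σ)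

  module Class {N} (B₀ : Vec ℕ N) (isB₀ : IsBoard N m B₀) where

    member-↭ : ∀ B → InClass N m B₀ B → omega m B ↭ omega m B₀
    member-↭ B (isB , equiv) = fileEquiv⇒↭ B B₀ isB isB₀ equiv

    member-admissible : ∀ B → InClass N m B₀ B → Admissible m (omega m B)
    member-admissible B (isB , _) = board-admissible m B isB

    realize : ∀ ys → Admissible m ys → ys ↭ omega m B₀ → Σ (Vec ℕ N) λ B → InClass N m B₀ B × omega m B ≡ ys
    realize ys adm σ with board-of m N ys adm (trans (PermP.↭-length σ) (length-omega m B₀))
    ... | B , isB , ωB≡ys = B , (isB , ↭⇒fileEquiv B B₀ isB isB₀ (subst (_↭ omega m B₀) (sym ωB≡ys) σ)) , ωB≡ys

    -- The minimum: the board whose ω is weakly increasing.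
    minimum : Σ (Vec ℕ N) λ B₁ → InClass N m B₀ B₁
                × (∀ B → InClass N m B₀ B → dinv m B₁ ≤ dinv m B)
                × (∀ B → InClass N m B₀ B → (∀ B′ → InClass N m B₀ B′ → dinv m B ≤ dinv m B′) → B ≡ B₁)
    minimum with sorted-arrangement m (omega m B₀) (board-admissible m B₀ isB₀)
    ... | ys , adm , σ , sorted with realize ys adm σ
    ...   | B₁ , inC₁ , refl = B₁ , inC₁ , smallest , unique
      where
      to-ys : ∀ B → InClass N m B₀ B → omega m B ↭ ys
      to-ys B inC = ↭-trans (member-↭ B inC) (↭-sym σ)
      -- asc (ω B) + desc (ω B) = asc ys, as ys has no m-descents.
      asc-desc : ∀ B → InClass N m B₀ B → asc m (omega m B) ℕ.+ desc m (omega m B) ≡ asc m ys ℕ.+ 0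
      asc-desc B inC = trans (asc+desc-↭ (to-ys B inC)) (cong (asc m ys ℕ.+_) (sorted⇒desc-zero m sorted))
      smallest : ∀ B → InClass N m B₀ B → dinv m B₁ ≤ dinv m B
      smallest B inC = trade (dinvSeq+asc-↭ (↭-sym (to-ys B inC))) (trade (asc-desc B inC) z≤n)
      unique : ∀ B → InClass N m B₀ B → (∀ B′ → InClass N m B₀ B′ → dinv m B ≤ dinv m B′) → B ≡ B₁
      unique B inC minimal = omega-injective m B B₁
        (sorted-unique _ _ (desc-zero⇒sorted m _ (member-admissible B inC) no-descents) sorted (to-ys B inC))
        where
        no-descents : desc m (omega m B) ≡ 0
        no-descents = ℕP.n≤0⇒n≡0 (trade⁻ (sym (asc-desc B inC)) (trade⁻ (dinvSeq+asc-↭ (to-ys B inC)) (minimal B₁ inC₁)))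

    -- The maximum: the board whose ω has as few m-ascents as possible.
    maximum : Σ (Vec ℕ N) λ B₂ → InClass N m B₀ B₂
                × (∀ B → InClass N m B₀ B → dinv m B ≤ dinv m B₂)
                × (∀ B → InClass N m B₀ B → (∀ B′ → InClass N m B₀ B′ → dinv m B′ ≤ dinv m B) → B ≡ B₂)
    maximum with tight-arrangement m (omega m B₀) (board-admissible m B₀ isB₀)
    ... | ys , adm , σ , tight with realize ys adm σ
    ...   | B₂ , inC₂ , refl = B₂ , inC₂ , largest , unique
      where
      to-ys : ∀ B → InClass N m B₀ B → omega m B ↭ ys
      to-ys B inC = ↭-trans (member-↭ B inC) (↭-sym σ)
      -- asc ys ≤ positives ys = positives (ω B) ≤ asc (ω B).
      fewest-ascents : ∀ B → InClass N m B₀ B → asc m ys ≤ asc m (omega m B)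
      fewest-ascents B inC = ℕP.≤-trans tight (ℕP.≤-trans (ℕP.≤-reflexive (positives-↭ (↭-sym (to-ys B inC))))
                                                         (positives≤asc m (omega m B) (member-admissible B inC)))
      largest : ∀ B → InClass N m B₀ B → dinv m B ≤ dinv m B₂
      largest B inC = trade (dinvSeq+asc-↭ (to-ys B inC)) (fewest-ascents B inC)
      unique : ∀ B → InClass N m B₀ B → (∀ B′ → InClass N m B₀ B′ → dinv m B′ ≤ dinv m B) → B ≡ B₂
      unique B inC maximal = omega-injective m B B₂
        (tight-unique m _ (member-admissible B inC) ys adm (to-ys B inC) tight-B tight)
        where
        tight-B : asc m (omega m B) ≤ positives m (omega m B)
        tight-B = ℕP.≤-trans (trade⁻ (dinvSeq+asc-↭ (↭-sym (to-ys B inC))) (maximal B₂ inC₂))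
                             (ℕP.≤-trans tight (ℕP.≤-reflexive (positives-↭ (↭-sym (to-ys B inC)))))

corollary8p6 : (m N : ℕ) → 1 ≤ m → (B₀ : Vec ℕ N) → IsBoard N m B₀ →
    (Σ (Vec ℕ N) λ B₁ → InClass N m B₀ B₁
    × (∀ B → InClass N m B₀ B → dinv m B₁ ≤ dinv m B)
    × (∀ B → InClass N m B₀ B → (∀ B' → InClass N m B₀ B' → dinv m B ≤ dinv m B') → B ≡ B₁))
    × (Σ (Vec ℕ N) λ B₂ → InClass N m B₀ B₂
    × (∀ B → InClass N m B₀ B → dinv m B ≤ dinv m B₂)
    × (∀ B → InClass N m B₀ B → (∀ B' → InClass N m B₀ B' → dinv m B' ≤ dinv m B) → B ≡ B₂))
corollary8p6 m N _ B₀ isB₀ = Class.minimum m B₀ isB₀ , Class.maximum m B₀ isB₀
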